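{- Let $r\geq 2$ and $n\geq 1$, and let $G=K_{n,n,\ldots,n}$ be the complete $r$-partite graph with parts of size $n$. Let $E$ be the set of $r$-element subsets of $V(G)$ that span a copy of $K_r$ in $G$ (i.e. contain exactly one vertex from each part), so $|E|=n^r$. Choose a uniformly random ordering of $E$ and form an $r$-uniform hypergraph $G_\omega$ on $V(G)$ by adding the elements of $E$ as edges in this order, stopping at the first moment when every vertex is contained in at least one edge. Then the expected number of matchings in $G_\omega$ is $$(n!)^{r-1}\sum_{i=1}^{r}(-1)^{i-1}\frac{\binom{r}{i}}{\binom{n^r-(n-1)^i n^{r-i}+n-1}{n}}.$$
   Context: A matching in an $r$-uniform hypergraph on vertex set $V$ is a set $M$ of its edges such that every vertex of $V$ lies in exactly one edge of $M$. -}

module Defs where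

open import Data.Nat using (ℕ; zero; suc; _∸_; _^_; _!) renaming (_+_ to _+ℕ_; _*_ to _*ℕ_)
open import Data.Nat.Combinatorics using (_C_)
open import Data.Integer using (+_)
open import Data.Rational using (ℚ; _/_; _+_; _*_; -_; 0ℚ; 1ℚ)
open import Data.Fin using (Fin)
open import Data.Fin.Properties using (all?) renaming (_≟_ to _≟ᶠ_)
open import Data.Vec using (Vec; lookup; []; _∷_)
open import Data.List using (List; []; _∷_; [_]; _++_; map; concatMap; length; filter; foldr; allFin; upTo)
open import Data.List.Relation.Unary.Any using (Any; any?)
open import Data.Product using (_×_)
open import Relation.Nullary using (Dec; yes; no)
open import Relation.Binary.PropositionalEquality using (_≡_)
import Data.Nat.Properties as ℕₚ

insertions : {A : Set} → A → List A → List (List A)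
insertions x [] = [ x ∷ [] ]
insertions x (y ∷ ys) = (x ∷ y ∷ ys) ∷ map (y ∷_) (insertions x ys)

-- all orderings (permutations) of a list; for a duplicate-free list of
-- length N this lists each of the N! orderings exactly once
perms : {A : Set} → List A → List (List A)
perms [] = [ [] ]
perms (x ∷ xs) = concatMap (insertions x) (perms xs)

subsets : {A : Set} → List A → List (List A)
subsets [] = [ [] ]
subsets (x ∷ xs) = let s = subsets xs in s ++ map (x ∷_) s

allVecs : (r n : ℕ) → List (Vec (Fin n) r)
allVecs zero n = [ [] ]
allVecs (suc r) n = concatMap (λ v → map (v ∷_) (allVecs r n)) (allFin n)

-- The complete r-partite graph K_{n,...,n}
-- Vertex set V(G) = Fin r × Fin n : the vertex (i , v) is vertex v of part i.
-- An r-set containing exactly one vertex from each part is encoded by the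
-- vector e : Vec (Fin n) r listing its vertex in each part; so the vertex
-- (i , v) belongs to the edge e iff  lookup e i ≡ v.

Edge : ℕ → ℕ → Set
Edge r n = Vec (Fin n) r

allEdges : (r n : ℕ) → List (Edge r n)
allEdges = allVecs

Covers : {r n : ℕ} → List (Edge r n) → Set
Covers {r} {n} es = (i : Fin r) (v : Fin n) → Any (λ e → lookup e i ≡ v) es

covers? : {r n : ℕ} (es : List (Edge r n)) → Dec (Covers es)
covers? es = all? (λ i → all? (λ v → any? (λ e → lookup e i ≟ᶠ v) es))

stopFrom : {r n : ℕ} → List (Edge r n) → List (Edge r n) → List (Edge r n)
stopFrom acc [] = acc
stopFrom acc (e ∷ es) with covers? acc
... | yes _ = acc
... | no  _ = stopFrom (acc ++ [ e ]) es

stoppedHypergraph : {r n : ℕ} → List (Edge r n) → List (Edge r n)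
stoppedHypergraph ω = stopFrom [] ω

IsMatching : {r n : ℕ} → List (Edge r n) → Set
IsMatching {r} {n} M =
  (i : Fin r) (v : Fin n) → length (filter (λ e → lookup e i ≟ᶠ v) M) ≡ 1

isMatching? : {r n : ℕ} (M : List (Edge r n)) → Dec (IsMatching M)
isMatching? M = all? (λ i → all? (λ v → length (filter (λ e → lookup e i ≟ᶠ v) M) ℕₚ.≟ 1))

numMatchings : {r n : ℕ} → List (Edge r n) → ℕ
numMatchings H = length (filter isMatching? (subsets H))

-- p / d as a rational; the value at d = 0 is an irrelevant convention
-- (it is never used below, all denominators are positive).
frac : ℕ → ℕ → ℚ
frac p zero = 0ℚ
frac p (suc d) = (+ p) / suc d

sumℚ : List ℚ → ℚ
sumℚ = foldr _+_ 0ℚ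

sumℕ : List ℕ → ℕ
sumℕ = foldr _+ℕ_ 0

sign : ℕ → ℚ
sign zero = 1ℚ
sign (suc j) = - sign j

-- E[# matchings of G_ω] for ω a uniformly random ordering of E:
-- (sum over all (n^r)! orderings) / (n^r)!
expectedMatchings : (r n : ℕ) → ℚ
expectedMatchings r n =
  frac (sumℕ (map (λ ω → numMatchings (stoppedHypergraph ω)) (perms (allEdges r n))))
       ((n ^ r) !)

-- (n!)^{r-1} Σ_{i=1}^{r} (-1)^{i-1} C(r,i) / C(n^r - (n-1)^i n^{r-i} + n - 1, n)
-- (the i-th summand is written with j = i - 1, i = suc j)
formula : (r n : ℕ) → ℚ
formula r n =
  frac ((n !) ^ (r ∸ 1)) 1 *
  sumℚ (map (λ j → sign j *
                   frac (r C suc j)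
                        (((n ^ r) ∸ ((n ∸ 1) ^ suc j *ℕ n ^ (r ∸ suc j)) +ℕ (n ∸ 1)) C n))
            (upTo r))

-- The number of matchings of the stopped hypergraph
-- G_ω is the number of perfect matchings T of K_{n,…,n} contained in G_ω, and T ⊆ G_ω exactly when
-- the last edge x of T to appear still has a vertex that no earlier edge covers. Inclusion–exclusion
-- over the set σ of parts in which that vertex may lie reduces this to orderings in which the n − 1
-- other edges of T precede x and the a − 1 edges meeting x in a part of σ follow it, where
-- a = n^r − (n−1)^|σ| n^(r−|σ|); a uniformly random ordering does so with probability
-- (n−1)! (a−1)! / (n+a−1)!. Summing over the n choices of x gives n (n−1)! (a−1)! / (n+a−1)!
-- = 1 / C(n+a−1, n), and there are (n!)^(r−1) perfect matchings.

module Submission where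

open import Defs
open import Algebra.Bundles using (CommutativeSemiring; CommutativeRing)
open import Data.Bool using (Bool; true; false; not; _∧_; _∨_; if_then_else_)
import Data.Bool.Properties as 𝔹
open import Data.Empty using (⊥; ⊥-elim)
open import Data.Fin using (Fin) renaming (_≟_ to _≟ᶠ_)
import Data.Fin as Fin
import Data.Fin.Properties as Fin
import Data.Integer as ℤ
import Data.Integer.Properties as ℤ
open import Data.List
  using (List; []; _∷_; [_]; _++_; map; concatMap; length; filter; filterᵇ; allFin; applyUpTo; upTo; replicate)
import Data.List.Properties as List
open import Data.List.Membership.Propositional using (_∈_; _∉_; find; lose)
open import Data.List.Membership.Propositional.Properties
  using (∈-++⁻; ∈-++⁺ˡ; ∈-++⁺ʳ; ∈-map⁺; ∈-map⁻; ∈-allFin; ∈-concatMap⁺)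
open import Data.List.Relation.Binary.Permutation.Propositional
  using (_↭_; refl; prep; swap; trans; ↭-reflexive; ↭-sym; ↭-trans)
open import Data.List.Relation.Binary.Permutation.Propositional.Properties
  using (++⁺; ++⁺ˡ; shift; shifts; ↭-length)
import Data.List.Relation.Binary.Permutation.Propositional.Properties as ↭
open import Data.List.Relation.Binary.Subset.Propositional using (_⊆_)
open import Data.List.Relation.Unary.All as All using (All; []; _∷_)
import Data.List.Relation.Unary.All.Properties as All
open import Data.List.Relation.Unary.AllPairs using ([]; _∷_)
open import Data.List.Relation.Unary.Any as Any using (Any; here; there)
open import Data.List.Relation.Unary.Unique.Propositional using (Unique)
open import Data.List.Relation.Unary.Unique.Propositional.Properties using (allFin⁺)
open import Data.Nat using (ℕ; zero; suc; _∸_; _^_; _!; _≤_; _<_; z≤n; s≤s; NonZero)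
open import Data.Nat.Combinatorics
  using (_C_; nCk+nC[k+1]≡[n+1]C[k+1]; k>n⇒nCk≡0; nCk≡n!/k![n-k]!; k![n∸k]!∣n!)
open import Data.Nat.DivMod using (m/n*n≡m)
import Data.Nat.Properties as ℕ
import Data.Nat.Solver as ℕ-Solver
open import Algebra.Properties.CommutativeSemigroup ℕ.+-commutativeSemigroup
  using () renaming (interchange to +-interchange)
open import Data.Product using (_×_; _,_; proj₁; proj₂; ∃; ∃₂)
open import Data.Rational using (ℚ; 0ℚ; 1ℚ)
import Data.Rational as ℚ
import Data.Rational.Properties as ℚ
open import Data.Rational.Solver using (module +-*-Solver)
open import Data.Rational.Unnormalised using (mkℚᵘ; *≡*) renaming (_≃_ to _≃ᵘ_)
import Data.Rational.Unnormalised.Properties as ℚᵘ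
open import Data.Sum using (_⊎_; inj₁; inj₂)
open import Data.Vec using (Vec; lookup) renaming (_∷_ to _∷ᵛ_)
open import Data.Vec.Functional using () renaming (_∷_ to _∷ᶠ_)
import Data.Vec.Properties as Vec
open import Function using (_∘_)
open import Function.Bundles using (mk⇔)
open import Relation.Binary.Definitions using (DecidableEquality)
open import Relation.Binary.PropositionalEquality
  using (_≡_; _≢_; refl; sym; cong; cong₂; subst; subst₂; module ≡-Reasoning)
  renaming (trans to ≡-trans)
open import Relation.Nullary using (Dec; yes; no; does; ¬_)
open import Relation.Nullary.Decidable using (T?; dec-true; dec-false; does-⇔)

module FiniteSum {c ℓ} (R : CommutativeSemiring c ℓ) where

  open CommutativeSemiring R
    renaming (refl to ≈-refl; sym to ≈-sym; trans to ≈-trans)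
  open import Relation.Binary.Reasoning.Setoid setoid
  open import Algebra.Properties.CommutativeSemigroup +-commutativeSemigroup using (interchange)

  ∑ : {A : Set} → (A → Carrier) → List A → Carrier
  ∑ f [] = 0#
  ∑ f (x ∷ xs) = f x + ∑ f xs

  module _ {A : Set} where

    ∑-++ : (f : A → Carrier) (xs ys : List A) → ∑ f (xs ++ ys) ≈ ∑ f xs + ∑ f ys
    ∑-++ f [] ys = ≈-sym (+-identityˡ _)
    ∑-++ f (x ∷ xs) ys = ≈-trans (+-congˡ (∑-++ f xs ys)) (≈-sym (+-assoc _ _ _))

    ∑-cong-All : {f g : A → Carrier} {xs : List A} → All (λ x → f x ≈ g x) xs → ∑ f xs ≈ ∑ g xs
    ∑-cong-All [] = ≈-refl
    ∑-cong-All (e ∷ es) = +-cong e (∑-cong-All es)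

    ∑-cong : {f g : A → Carrier} → (∀ x → f x ≈ g x) → (xs : List A) → ∑ f xs ≈ ∑ g xs
    ∑-cong e [] = ≈-refl
    ∑-cong e (x ∷ xs) = +-cong (e x) (∑-cong e xs)

    ∑-zero : (xs : List A) → ∑ (λ _ → 0#) xs ≈ 0#
    ∑-zero [] = ≈-refl
    ∑-zero (x ∷ xs) = ≈-trans (+-identityˡ _) (∑-zero xs)

    ∑-+ : (f g : A → Carrier) (xs : List A) → ∑ (λ x → f x + g x) xs ≈ ∑ f xs + ∑ g xs
    ∑-+ f g [] = ≈-sym (+-identityˡ 0#)
    ∑-+ f g (x ∷ xs) = ≈-trans (+-congˡ (∑-+ f g xs)) (interchange (f x) (g x) (∑ f xs) (∑ g xs))

    ∑-*ˡ : (a : Carrier) (f : A → Carrier) (xs : List A) → ∑ (λ x → a * f x) xs ≈ a * ∑ f xs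
    ∑-*ˡ a f [] = ≈-sym (zeroʳ a)
    ∑-*ˡ a f (x ∷ xs) = ≈-trans (+-congˡ (∑-*ˡ a f xs)) (≈-sym (distribˡ a _ _))

    ∑-↭ : (f : A → Carrier) {xs ys : List A} → xs ↭ ys → ∑ f xs ≈ ∑ f ys
    ∑-↭ f refl = ≈-refl
    ∑-↭ f (prep x p) = +-congˡ (∑-↭ f p)
    ∑-↭ f {x ∷ y ∷ xs} {y ∷ x ∷ ys} (swap x y p) = begin
      f x + (f y + ∑ f xs) ≈⟨ ≈-sym (+-assoc _ _ _) ⟩
      (f x + f y) + ∑ f xs ≈⟨ +-cong (+-comm _ _) (∑-↭ f p) ⟩
      (f y + f x) + ∑ f ys ≈⟨ +-assoc _ _ _ ⟩
      f y + (f x + ∑ f ys) ∎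
    ∑-↭ f (trans p q) = ≈-trans (∑-↭ f p) (∑-↭ f q)

  module _ {A B : Set} where

    ∑-map : (f : B → Carrier) (g : A → B) (xs : List A) → ∑ f (map g xs) ≈ ∑ (f ∘ g) xs
    ∑-map f g [] = ≈-refl
    ∑-map f g (x ∷ xs) = +-congˡ (∑-map f g xs)

    ∑-concatMap : (f : B → Carrier) (g : A → List B) (xs : List A) →
                  ∑ f (concatMap g xs) ≈ ∑ (λ x → ∑ f (g x)) xs
    ∑-concatMap f g [] = ≈-refl
    ∑-concatMap f g (x ∷ xs) = ≈-trans (∑-++ f (g x) (concatMap g xs)) (+-congˡ (∑-concatMap f g xs))

    ∑-comm : (f : A → B → Carrier) (xs : List A) (ys : List B) →
             ∑ (λ x → ∑ (f x) ys) xs ≈ ∑ (λ y → ∑ (λ x → f x y) xs) ys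
    ∑-comm f [] ys = ≈-sym (∑-zero ys)
    ∑-comm f (x ∷ xs) ys =
      ≈-trans (+-congˡ (∑-comm f xs ys)) (≈-sym (∑-+ (f x) (λ y → ∑ (λ x → f x y) xs) ys))

  ∑-applyUpTo : (f : ℕ → Carrier) (g : ℕ → ℕ) (m : ℕ) → ∑ f (applyUpTo g m) ≈ ∑ (f ∘ g) (upTo m)
  ∑-applyUpTo f g zero = ≈-refl
  ∑-applyUpTo f g (suc m) =
    +-congˡ (≈-trans (∑-applyUpTo f (g ∘ suc) m) (≈-sym (∑-applyUpTo (f ∘ g) suc m)))

  ∑-upTo-suc : (f : ℕ → Carrier) (m : ℕ) → ∑ f (upTo (suc m)) ≈ f 0 + ∑ (f ∘ suc) (upTo m)
  ∑-upTo-suc f m = +-congˡ (∑-applyUpTo f suc m)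

open import Data.Nat using (_+_; _*_)

open FiniteSum ℕ.+-*-commutativeSemiring

𝟙 : Bool → ℕ
𝟙 true = 1
𝟙 false = 0

true≢false : true ≢ false
true≢false ()

∧-true⁻ : {a b : Bool} → a ∧ b ≡ true → a ≡ true × b ≡ true
∧-true⁻ {true} {true} _ = refl , refl

does-true⁻ : {P : Set} (d : Dec P) → does d ≡ true → P
does-true⁻ (yes p) _ = p

does-sym : {A : Set} (_≟_ : DecidableEquality A) (a b : A) → does (a ≟ b) ≡ does (b ≟ a)
does-sym _≟_ a b = does-⇔ (mk⇔ sym sym) (a ≟ b) (b ≟ a)

does-≡ : {P : Set} (d : Dec P) {b : Bool} → (P → b ≡ true) → (b ≡ true → P) → does d ≡ b
does-≡ (yes p) P⇒b b⇒P = sym (P⇒b p)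
does-≡ (no ¬p) {false} P⇒b b⇒P = refl
does-≡ (no ¬p) {true} P⇒b b⇒P = ⊥-elim (¬p (b⇒P refl))

_≡ᵇᶠ_ : {n : ℕ} → Fin n → Fin n → Bool
u ≡ᵇᶠ v = does (u ≟ᶠ v)

≡ᵇᶠ-refl : {n : ℕ} (v : Fin n) → v ≡ᵇᶠ v ≡ true
≡ᵇᶠ-refl v = dec-true (v ≟ᶠ v) refl

countᵇ : {A : Set} → (A → Bool) → List A → ℕ
countᵇ P = ∑ (𝟙 ∘ P)

∑-const : {A : Set} (c : ℕ) (xs : List A) → ∑ (λ _ → c) xs ≡ length xs * c
∑-const c [] = refl
∑-const c (x ∷ xs) = cong (c +_) (∑-const c xs)

∑-ones : {A : Set} (xs : List A) → ∑ (λ _ → 1) xs ≡ length xs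
∑-ones xs = ≡-trans (∑-const 1 xs) (ℕ.*-identityʳ _)

module _ {A : Set} where

  countᵇ-split : (Q P : A → Bool) (xs : List A) →
                 countᵇ Q xs ≡ countᵇ (λ y → Q y ∧ P y) xs + countᵇ (λ y → Q y ∧ not (P y)) xs
  countᵇ-split Q P [] = refl
  countᵇ-split Q P (x ∷ xs) with Q x | P x
  ... | true | true = cong suc (countᵇ-split Q P xs)
  ... | true | false = ≡-trans (cong suc (countᵇ-split Q P xs)) (sym (ℕ.+-suc _ _))
  ... | false | _ = countᵇ-split Q P xs

  countᵇ-cong : {P Q : A → Bool} → (∀ y → P y ≡ Q y) → (xs : List A) → countᵇ P xs ≡ countᵇ Q xs
  countᵇ-cong e = ∑-cong (cong 𝟙 ∘ e)

  countᵇ-all : (P : A → Bool) {ζ : List A} → All (λ z → P z ≡ true) ζ → countᵇ P ζ ≡ length ζ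
  countᵇ-all P [] = refl
  countᵇ-all P (e ∷ es) rewrite e = cong suc (countᵇ-all P es)

  countᵇ-none : (P : A → Bool) {ζ : List A} → All (λ z → P z ≡ false) ζ → countᵇ P ζ ≡ 0
  countᵇ-none P [] = refl
  countᵇ-none P (e ∷ es) rewrite e = countᵇ-none P es

  countᵇ-mono : (P Q : A → Bool) → (∀ y → P y ≡ true → Q y ≡ true) → (xs : List A) → countᵇ P xs ≤ countᵇ Q xs
  countᵇ-mono P Q P⇒Q [] = z≤n
  countᵇ-mono P Q P⇒Q (x ∷ xs) with P x in Px
  ... | true rewrite P⇒Q x Px = s≤s (countᵇ-mono P Q P⇒Q xs)
  ... | false = ℕ.≤-trans (countᵇ-mono P Q P⇒Q xs) (ℕ.m≤n+m _ (𝟙 (Q x)))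

  countᵇ-witness : (P : A → Bool) (xs : List A) {k : ℕ} → countᵇ P xs ≡ suc k → ∃ λ y → y ∈ xs × P y ≡ true
  countᵇ-witness P (x ∷ xs) count with P x in Px
  ... | true = x , here refl , Px
  ... | false with countᵇ-witness P xs count
  ...   | y , y∈xs , Py = y , there y∈xs , Py

  countᵇ-pos : (P : A → Bool) {y : A} {xs : List A} → y ∈ xs → P y ≡ true → 1 ≤ countᵇ P xs
  countᵇ-pos P (here refl) Py rewrite Py = s≤s z≤n
  countᵇ-pos P {xs = x ∷ xs} (there y∈xs) Py = ℕ.≤-trans (countᵇ-pos P y∈xs Py) (ℕ.m≤n+m _ (𝟙 (P x)))

  countᵇ-zero : (P : A → Bool) {xs : List A} → countᵇ P xs ≡ 0 → {y : A} → y ∈ xs → P y ≡ false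
  countᵇ-zero P count≡0 {y} y∈xs with P y in Py
  ... | false = refl
  ... | true = ⊥-elim (ℕ.<-irrefl refl (subst (1 ≤_) count≡0 (countᵇ-pos P y∈xs Py)) )

module _ {A : Set} where

  length-insertions : (x : A) (l : List A) → length (insertions x l) ≡ suc (length l)
  length-insertions x [] = refl
  length-insertions x (y ∷ l) =
    cong suc (≡-trans (List.length-map (y ∷_) (insertions x l)) (length-insertions x l))

  insertions-↭ : (x : A) (l : List A) → All (_↭ x ∷ l) (insertions x l)
  insertions-↭ x [] = refl ∷ []
  insertions-↭ x (y ∷ l) =
    refl ∷ All.map⁺ (All.map (λ p → trans (prep y p) (swap y x refl)) (insertions-↭ x l))

  perms-↭ : (E : List A) → All (_↭ E) (perms E)
  perms-↭ [] = refl ∷ []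
  perms-↭ (x ∷ E) = All.concat⁺ (All.map⁺
    (All.map (λ {w} p → All.map (λ q → trans q (prep x p)) (insertions-↭ x w)) (perms-↭ E)))

  ∑-perms-∷ : (f : List A → ℕ) (y : A) (L : List A) →
              (∀ l → All (λ w → f w ≡ f l) (insertions y l)) →
              ∑ f (perms (y ∷ L)) ≡ suc (length L) * ∑ f (perms L)
  ∑-perms-∷ f y L f-ignores-y = begin
      ∑ f (concatMap (insertions y) (perms L))
    ≡⟨ ∑-concatMap f (insertions y) (perms L) ⟩
      ∑ (λ l → ∑ f (insertions y l)) (perms L)
    ≡⟨ ∑-cong-All (All.map (λ {l} p → ≡-trans (∑-cong-All (f-ignores-y l)) (insertion-count l p)) (perms-↭ L)) ⟩
      ∑ (λ l → suc (length L) * f l) (perms L)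
    ≡⟨ ∑-*ˡ (suc (length L)) f (perms L) ⟩
      suc (length L) * ∑ f (perms L) ∎
    where
      open ≡-Reasoning
      insertion-count : ∀ l → l ↭ L → ∑ (λ _ → f l) (insertions y l) ≡ suc (length L) * f l
      insertion-count l p = ≡-trans (∑-const (f l) (insertions y l))
        (cong (_* f l) (≡-trans (length-insertions y l) (cong suc (↭-length p))))

  length-perms : (E : List A) → length (perms E) ≡ length E !
  length-perms [] = refl
  length-perms (x ∷ E) = begin
      length (perms (x ∷ E))
    ≡⟨ ∑-ones (perms (x ∷ E)) ⟨
      ∑ (λ _ → 1) (perms (x ∷ E))
    ≡⟨ ∑-perms-∷ (λ _ → 1) x E (λ l → All.tabulate (λ _ → refl)) ⟩
      suc (length E) * ∑ (λ _ → 1) (perms E)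
    ≡⟨ cong (suc (length E) *_) (≡-trans (∑-ones (perms E)) (length-perms E)) ⟩
      suc (length E) ! ∎
    where open ≡-Reasoning

module _ {A B : Set} (g : A → List B) where

  concatMap⁺ : {xs ys : List A} → xs ↭ ys → concatMap g xs ↭ concatMap g ys
  concatMap⁺ refl = refl
  concatMap⁺ (prep x p) = ++⁺ˡ (g x) (concatMap⁺ p)
  concatMap⁺ (swap x y p) = ↭-trans (shifts (g x) (g y)) (++⁺ˡ (g y) (++⁺ˡ (g x) (concatMap⁺ p)))
  concatMap⁺ (trans p q) = ↭-trans (concatMap⁺ p) (concatMap⁺ q)

  concatMap-concatMap : {C : Set} (f : B → List C) (xs : List A) →
                        concatMap f (concatMap g xs) ≡ concatMap (concatMap f ∘ g) xs
  concatMap-concatMap f [] = refl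
  concatMap-concatMap f (x ∷ xs) = ≡-trans (List.concatMap-++ f (g x) (concatMap g xs))
    (cong (concatMap f (g x) ++_) (concatMap-concatMap f xs))

concatMap-cong-↭ : {A B : Set} {g h : A → List B} → (∀ x → g x ↭ h x) →
                   (xs : List A) → concatMap g xs ↭ concatMap h xs
concatMap-cong-↭ e [] = refl
concatMap-cong-↭ e (x ∷ xs) = ++⁺ (e x) (concatMap-cong-↭ e xs)

module _ {A : Set} where

  private
    insertions-map-∷ : (x z : A) (W : List (List A)) →
      concatMap (insertions x) (map (z ∷_) W) ↭ map (x ∷_) (map (z ∷_) W) ++ map (z ∷_) (concatMap (insertions x) W)
    insertions-map-∷ x z [] = refl
    insertions-map-∷ x z (w ∷ W) = prep (x ∷ z ∷ w) (↭-trans (++⁺ˡ zx (insertions-map-∷ x z W))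
      (↭-trans (shifts zx (map (x ∷_) (map (z ∷_) W)))
        (++⁺ˡ (map (x ∷_) (map (z ∷_) W))
          (↭-reflexive (sym (List.map-++ (z ∷_) (insertions x w) (concatMap (insertions x) W)))))))
      where zx = map (z ∷_) (insertions x w)

  insertions-comm : (x y : A) (l : List A) →
    concatMap (insertions x) (insertions y l) ↭ concatMap (insertions y) (insertions x l)
  insertions-comm x y [] = swap _ _ refl
  insertions-comm x y (z ∷ l) =
    ↭-trans (prep _ (prep _ (++⁺ˡ P (insertions-map-∷ x z (insertions y l)))))
      (↭-trans (swap _ _ (↭-trans (shifts P Q) (++⁺ˡ Q (++⁺ˡ P (↭.map⁺ (z ∷_) (insertions-comm x y l))))))
        (↭-sym (prep _ (prep _ (++⁺ˡ Q (insertions-map-∷ y z (insertions x l)))))))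
    where
      P = map (y ∷_) (map (z ∷_) (insertions x l))
      Q = map (x ∷_) (map (z ∷_) (insertions y l))

  perms⁺ : {E F : List A} → E ↭ F → perms E ↭ perms F
  perms⁺ refl = refl
  perms⁺ (prep x p) = concatMap⁺ (insertions x) (perms⁺ p)
  perms⁺ {x ∷ y ∷ E} {y ∷ x ∷ F} (swap x y p) =
    ↭-trans (concatMap⁺ (insertions x) (concatMap⁺ (insertions y) (perms⁺ p)))
      (subst₂ _↭_ (sym (concatMap-concatMap (insertions y) (insertions x) (perms F)))
                  (sym (concatMap-concatMap (insertions x) (insertions y) (perms F)))
              (concatMap-cong-↭ (insertions-comm x y) (perms F)))
  perms⁺ (trans p q) = ↭-trans (perms⁺ p) (perms⁺ q)

∑-perms-↭ : {A : Set} (f : List A → ℕ) {E F : List A} → E ↭ F → ∑ f (perms E) ≡ ∑ f (perms F)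
∑-perms-↭ f p = ∑-↭ f (perms⁺ p)

module Orderings {A : Set} (_≟_ : DecidableEquality A) where

  noneOf : (A → Bool) → List A → Bool
  noneOf P [] = true
  noneOf P (z ∷ zs) = not (P z) ∧ noneOf P zs

  noneAfter : A → (A → Bool) → List A → Bool
  noneAfter x P [] = false
  noneAfter x P (z ∷ zs) = if does (z ≟ x) then noneOf P zs else noneAfter x P zs

  noneBefore : A → (A → Bool) → List A → Bool
  noneBefore x P [] = false
  noneBefore x P (z ∷ zs) = if does (z ≟ x) then true else not (P z) ∧ noneBefore x P zs

  separates : A → (A → Bool) → (A → Bool) → List A → Bool
  separates x L R ω = noneAfter x L ω ∧ noneBefore x R ω

  leading : (A → Bool) → List A → Bool
  leading L [] = true
  leading L (z ∷ ζ) = if L z then leading L ζ else noneOf L ζ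

  module _ (x : A) (P : A → Bool) where

    noneAfter-here : (w : List A) → noneAfter x P (x ∷ w) ≡ noneOf P w
    noneAfter-here w rewrite dec-true (x ≟ x) refl = refl

    noneAfter-there : {y : A} → y ≢ x → (w : List A) → noneAfter x P (y ∷ w) ≡ noneAfter x P w
    noneAfter-there {y} y≢x w rewrite dec-false (y ≟ x) y≢x = refl

    noneBefore-here : (w : List A) → noneBefore x P (x ∷ w) ≡ true
    noneBefore-here w rewrite dec-true (x ≟ x) refl = refl

    noneBefore-there : {y : A} → y ≢ x → (w : List A) → noneBefore x P (y ∷ w) ≡ not (P y) ∧ noneBefore x P w
    noneBefore-there {y} y≢x w rewrite dec-false (y ≟ x) y≢x = refl

    module _ {y : A} (Py : P y ≡ false) where

      noneOf-skip : (w : List A) → noneOf P (y ∷ w) ≡ noneOf P w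
      noneOf-skip w = cong (λ b → not b ∧ noneOf P w) Py

      noneOf-insert : (l : List A) → All (λ w → noneOf P w ≡ noneOf P l) (insertions y l)
      noneOf-insert [] = noneOf-skip [] ∷ []
      noneOf-insert (z ∷ l) =
        noneOf-skip (z ∷ l) ∷ All.map⁺ (All.map (cong (not (P z) ∧_)) (noneOf-insert l))

      module _ (y≢x : y ≢ x) where

        noneAfter-insert : (l : List A) → All (λ w → noneAfter x P w ≡ noneAfter x P l) (insertions y l)
        noneAfter-insert [] = noneAfter-there y≢x [] ∷ []
        noneAfter-insert (z ∷ l) = noneAfter-there y≢x (z ∷ l) ∷ All.map⁺ behind-z
          where
            behind-z : All (λ w → noneAfter x P (z ∷ w) ≡ noneAfter x P (z ∷ l)) (insertions y l)
            behind-z with z ≟ x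
            ... | yes _ = noneOf-insert l
            ... | no _ = noneAfter-insert l

        noneBefore-skip : (w : List A) → noneBefore x P (y ∷ w) ≡ noneBefore x P w
        noneBefore-skip w = ≡-trans (noneBefore-there y≢x w) (cong (λ b → not b ∧ noneBefore x P w) Py)

        noneBefore-insert : (l : List A) → All (λ w → noneBefore x P w ≡ noneBefore x P l) (insertions y l)
        noneBefore-insert [] = noneBefore-skip [] ∷ []
        noneBefore-insert (z ∷ l) = noneBefore-skip (z ∷ l) ∷ All.map⁺ behind-z
          where
            behind-z : All (λ w → noneBefore x P (z ∷ w) ≡ noneBefore x P (z ∷ l)) (insertions y l)
            behind-z with z ≟ x
            ... | yes _ = All.tabulate (λ _ → refl)
            ... | no _ = All.map (cong (not (P z) ∧_)) (noneBefore-insert l)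

  module _ (L : A → Bool) {b : A} (Lb : L b ≡ true) where

    noneOf-has : (ζ : List A) → All (λ w → noneOf L w ≡ false) (insertions b ζ)
    noneOf-has [] = cong (λ t → not t ∧ true) Lb ∷ []
    noneOf-has (z ∷ ζ) = cong (λ t → not t ∧ noneOf L (z ∷ ζ)) Lb ∷
      All.map⁺ (All.map (λ e → ≡-trans (cong (not (L z) ∧_) e) (𝔹.∧-zeroʳ _)) (noneOf-has ζ))

    countᵇ-noneOf : (ζ : List A) → noneOf L ζ ≡ true → countᵇ L ζ ≡ 0
    countᵇ-noneOf [] _ = refl
    countᵇ-noneOf (z ∷ ζ) e with L z
    ... | false = countᵇ-noneOf ζ e

    ∑-insertions-leading : (ζ : List A) →
      ∑ (𝟙 ∘ leading L) (insertions b ζ) ≡ suc (countᵇ L ζ) * 𝟙 (leading L ζ)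
    ∑-insertions-leading [] = cong (λ t → 𝟙 (if t then true else true) + 0) Lb
    ∑-insertions-leading (z ∷ ζ) = ≡-trans
      (cong₂ _+_ (cong (λ t → 𝟙 (if t then leading L (z ∷ ζ) else noneOf L (z ∷ ζ))) Lb)
                 (∑-map (𝟙 ∘ leading L) (z ∷_) (insertions b ζ)))
      behind-z
      where
        behind-z : 𝟙 (leading L (z ∷ ζ)) + ∑ (λ w → 𝟙 (leading L (z ∷ w))) (insertions b ζ)
                   ≡ suc (countᵇ L (z ∷ ζ)) * 𝟙 (leading L (z ∷ ζ))
        behind-z with L z
        ... | true = cong (𝟙 (leading L ζ) +_) (∑-insertions-leading ζ)
        ... | false = ≡-trans (cong (𝟙 (noneOf L ζ) +_) (≡-trans (∑-cong-All (All.map (cong 𝟙) (noneOf-has ζ))) (∑-zero (insertions b ζ))))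
                              (only-z (noneOf L ζ) refl)
          where
            only-z : (t : Bool) → noneOf L ζ ≡ t → 𝟙 t + 0 ≡ suc (countᵇ L ζ) * 𝟙 t
            only-z true e rewrite countᵇ-noneOf ζ e = refl
            only-z false e = sym (ℕ.*-zeroʳ (suc (countᵇ L ζ)))

  module _ (L : A → Bool) where

    noneOf-intro : {ζ : List A} → All (λ z → L z ≡ false) ζ → noneOf L ζ ≡ true
    noneOf-intro [] = refl
    noneOf-intro (e ∷ es) rewrite e = noneOf-intro es

    leading-false : {ζ : List A} → All (λ z → L z ≡ false) ζ → leading L ζ ≡ true
    leading-false [] = refl
    leading-false (e ∷ es) rewrite e = noneOf-intro es

    ∑-perms-leading : (Ls Rs : List A) → All (λ z → L z ≡ true) Ls → All (λ z → L z ≡ false) Rs →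
                      ∑ (𝟙 ∘ leading L) (perms (Ls ++ Rs)) ≡ length Ls ! * length Rs !
    ∑-perms-leading [] Rs [] Rs-false = begin
        ∑ (𝟙 ∘ leading L) (perms Rs)
      ≡⟨ ∑-cong-All (All.map (λ p → cong 𝟙 (leading-false (↭.All-resp-↭ (↭-sym p) Rs-false))) (perms-↭ Rs)) ⟩
        ∑ (λ _ → 1) (perms Rs)
      ≡⟨ ≡-trans (∑-ones (perms Rs)) (length-perms Rs) ⟩
        length Rs !
      ≡⟨ ℕ.+-identityʳ _ ⟨
        1 * length Rs ! ∎
      where open ≡-Reasoning
    ∑-perms-leading (b ∷ Ls) Rs (Lb ∷ Ls-true) Rs-false = begin
        ∑ (𝟙 ∘ leading L) (concatMap (insertions b) (perms (Ls ++ Rs)))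
      ≡⟨ ∑-concatMap (𝟙 ∘ leading L) (insertions b) (perms (Ls ++ Rs)) ⟩
        ∑ (λ ζ → ∑ (𝟙 ∘ leading L) (insertions b ζ)) (perms (Ls ++ Rs))
      ≡⟨ ∑-cong-All (All.map (λ {ζ} p → ≡-trans (∑-insertions-leading L Lb ζ)
           (cong (λ k → suc k * 𝟙 (leading L ζ)) (≡-trans (∑-↭ (𝟙 ∘ L) p) count-L))) (perms-↭ (Ls ++ Rs))) ⟩
        ∑ (λ ζ → suc (length Ls) * 𝟙 (leading L ζ)) (perms (Ls ++ Rs))
      ≡⟨ ∑-*ˡ (suc (length Ls)) (𝟙 ∘ leading L) (perms (Ls ++ Rs)) ⟩
        suc (length Ls) * ∑ (𝟙 ∘ leading L) (perms (Ls ++ Rs))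
      ≡⟨ cong (suc (length Ls) *_) (∑-perms-leading Ls Rs Ls-true Rs-false) ⟩
        suc (length Ls) * (length Ls ! * length Rs !)
      ≡⟨ ℕ.*-assoc (suc (length Ls)) (length Ls !) (length Rs !) ⟨
        suc (length Ls) ! * length Rs ! ∎
      where
        open ≡-Reasoning
        count-L : countᵇ L (Ls ++ Rs) ≡ length Ls
        count-L = ≡-trans (∑-++ (𝟙 ∘ L) Ls Rs)
          (≡-trans (cong₂ _+_ (countᵇ-all L Ls-true) (countᵇ-none L Rs-false)) (ℕ.+-identityʳ _))

  module _ (x : A) (L R : A → Bool) where

    Only : Bool → Bool → A → Set
    Only b c z = z ≢ x × L z ≡ b × R z ≡ c

    private
      Sided : A → Set
      Sided z = Only true false z ⊎ Only false true z

      sided-≢ : {z : A} → Sided z → z ≢ x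
      sided-≢ (inj₁ (z≢x , _)) = z≢x
      sided-≢ (inj₂ (z≢x , _)) = z≢x

    ∑-insertions-separates : (ζ : List A) → All Sided ζ →
      ∑ (𝟙 ∘ separates x L R) (insertions x ζ) ≡ 𝟙 (leading L ζ)
    ∑-insertions-separates [] [] =
      cong (λ t → 𝟙 t + 0) (cong₂ _∧_ (noneAfter-here x L []) (noneBefore-here x R []))
    ∑-insertions-separates (z ∷ ζ) (side ∷ sides) = begin
        𝟙 (separates x L R (x ∷ z ∷ ζ)) + ∑ (𝟙 ∘ separates x L R) (map (z ∷_) (insertions x ζ))
      ≡⟨ cong₂ _+_ (cong 𝟙 (cong₂ _∧_ (noneAfter-here x L (z ∷ ζ)) (noneBefore-here x R (z ∷ ζ))))
                   (≡-trans (∑-map (𝟙 ∘ separates x L R) (z ∷_) (insertions x ζ))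
                            (∑-cong (λ w → cong 𝟙 (cong₂ _∧_ (noneAfter-there x L z≢x w) (noneBefore-there x R z≢x w)))
                                    (insertions x ζ))) ⟩
        𝟙 (noneOf L (z ∷ ζ) ∧ true) + ∑ (λ w → 𝟙 (noneAfter x L w ∧ (not (R z) ∧ noneBefore x R w))) (insertions x ζ)
      ≡⟨ by-side side ⟩
        𝟙 (leading L (z ∷ ζ)) ∎
      where
        open ≡-Reasoning
        z≢x = sided-≢ side
        by-side : Sided z →
          𝟙 (noneOf L (z ∷ ζ) ∧ true) + ∑ (λ w → 𝟙 (noneAfter x L w ∧ (not (R z) ∧ noneBefore x R w))) (insertions x ζ)
          ≡ 𝟙 (leading L (z ∷ ζ))
        by-side (inj₁ (_ , Lz , Rz)) rewrite Lz | Rz = ∑-insertions-separates ζ sides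
        by-side (inj₂ (_ , Lz , Rz)) rewrite Lz | Rz = begin
            𝟙 (noneOf L ζ ∧ true) + ∑ (λ w → 𝟙 (noneAfter x L w ∧ false)) (insertions x ζ)
          ≡⟨ cong (𝟙 (noneOf L ζ ∧ true) +_)
                  (≡-trans (∑-cong (λ w → cong 𝟙 (𝔹.∧-zeroʳ _)) (insertions x ζ)) (∑-zero (insertions x ζ))) ⟩
            𝟙 (noneOf L ζ ∧ true) + 0
          ≡⟨ ≡-trans (ℕ.+-identityʳ _) (cong 𝟙 (𝔹.∧-identityʳ _)) ⟩
            𝟙 (noneOf L ζ) ∎

    ∑-perms-separates : (Ls Rs : List A) → All (Only true false) Ls → All (Only false true) Rs →
      ∑ (𝟙 ∘ separates x L R) (perms (x ∷ Ls ++ Rs)) ≡ length Ls ! * length Rs !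
    ∑-perms-separates Ls Rs Ls-ok Rs-ok = begin
        ∑ (𝟙 ∘ separates x L R) (concatMap (insertions x) (perms (Ls ++ Rs)))
      ≡⟨ ∑-concatMap (𝟙 ∘ separates x L R) (insertions x) (perms (Ls ++ Rs)) ⟩
        ∑ (λ ζ → ∑ (𝟙 ∘ separates x L R) (insertions x ζ)) (perms (Ls ++ Rs))
      ≡⟨ ∑-cong-All (All.map (λ p → ∑-insertions-separates _ (↭.All-resp-↭ (↭-sym p) sided)) (perms-↭ (Ls ++ Rs))) ⟩
        ∑ (𝟙 ∘ leading L) (perms (Ls ++ Rs))
      ≡⟨ ∑-perms-leading L Ls Rs (All.map (proj₁ ∘ proj₂) Ls-ok) (All.map (proj₁ ∘ proj₂) Rs-ok) ⟩
        length Ls ! * length Rs ! ∎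
      where
        open ≡-Reasoning
        sided : All Sided (Ls ++ Rs)
        sided = All.++⁺ (All.map inj₁ Ls-ok) (All.map inj₂ Rs-ok)

    ∑-perms-separates-neutral : (Y Ls Rs : List A) →
      All (Only false false) Y → All (Only true false) Ls → All (Only false true) Rs →
      ∑ (𝟙 ∘ separates x L R) (perms (Y ++ x ∷ Ls ++ Rs)) * suc (length (Ls ++ Rs)) !
        ≡ length (Y ++ x ∷ Ls ++ Rs) ! * (length Ls ! * length Rs !)
    ∑-perms-separates-neutral [] Ls Rs [] Ls-ok Rs-ok =
      ≡-trans (cong (_* suc (length (Ls ++ Rs)) !) (∑-perms-separates Ls Rs Ls-ok Rs-ok))
              (ℕ.*-comm (length Ls ! * length Rs !) (suc (length (Ls ++ Rs)) !))
    ∑-perms-separates-neutral (y ∷ Y) Ls Rs ((y≢x , Ly , Ry) ∷ Y-ok) Ls-ok Rs-ok = begin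
        ∑ (𝟙 ∘ separates x L R) (perms (y ∷ E′)) * K
      ≡⟨ cong (_* K) (∑-perms-∷ (𝟙 ∘ separates x L R) y E′ y-invisible) ⟩
        (suc (length E′) * ∑ (𝟙 ∘ separates x L R) (perms E′)) * K
      ≡⟨ ℕ.*-assoc (suc (length E′)) (∑ (𝟙 ∘ separates x L R) (perms E′)) K ⟩
        suc (length E′) * (∑ (𝟙 ∘ separates x L R) (perms E′) * K)
      ≡⟨ cong (suc (length E′) *_) (∑-perms-separates-neutral Y Ls Rs Y-ok Ls-ok Rs-ok) ⟩
        suc (length E′) * (length E′ ! * (length Ls ! * length Rs !))
      ≡⟨ ℕ.*-assoc (suc (length E′)) (length E′ !) (length Ls ! * length Rs !) ⟨
        suc (length E′) ! * (length Ls ! * length Rs !) ∎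
      where
        open ≡-Reasoning
        E′ = Y ++ x ∷ Ls ++ Rs
        K = suc (length (Ls ++ Rs)) !
        y-invisible : ∀ l → All (λ w → 𝟙 (separates x L R w) ≡ 𝟙 (separates x L R l)) (insertions y l)
        y-invisible l = All.zipWith (λ (e₁ , e₂) → cong 𝟙 (cong₂ _∧_ e₁ e₂))
          (noneAfter-insert x L Ly y≢x l , noneBefore-insert x R Ry y≢x l)

    count-separates : (E Y Ls Rs : List A) → E ↭ Y ++ x ∷ Ls ++ Rs →
      All (Only false false) Y → All (Only true false) Ls → All (Only false true) Rs →
      ∑ (𝟙 ∘ separates x L R) (perms E) * suc (length Ls + length Rs) ! ≡ length E ! * (length Ls ! * length Rs !)
    count-separates E Y Ls Rs E↭ Y-ok Ls-ok Rs-ok = begin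
        ∑ (𝟙 ∘ separates x L R) (perms E) * suc (length Ls + length Rs) !
      ≡⟨ cong₂ (λ s k → s * suc k !) (∑-perms-↭ (𝟙 ∘ separates x L R) E↭) (sym (List.length-++ Ls)) ⟩
        ∑ (𝟙 ∘ separates x L R) (perms (Y ++ x ∷ Ls ++ Rs)) * suc (length (Ls ++ Rs)) !
      ≡⟨ ∑-perms-separates-neutral Y Ls Rs Y-ok Ls-ok Rs-ok ⟩
        length (Y ++ x ∷ Ls ++ Rs) ! * (length Ls ! * length Rs !)
      ≡⟨ cong (λ k → k ! * (length Ls ! * length Rs !)) (↭-length E↭) ⟨
        length E ! * (length Ls ! * length Rs !) ∎
      where open ≡-Reasoning

  _≡ᵇ_ : A → A → Bool
  y ≡ᵇ z = does (y ≟ z)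

  Once : List A → Set
  Once ω = ∀ z → countᵇ (_≡ᵇ z) ω ≡ 1

  ≡ᵇ-refl : (x : A) → x ≡ᵇ x ≡ true
  ≡ᵇ-refl x = dec-true (x ≟ x) refl

  ≡ᵇ-false⇒≢ : {y z : A} → y ≡ᵇ z ≡ false → y ≢ z
  ≡ᵇ-false⇒≢ {y} y≢ᵇy refl = true≢false (≡-trans (sym (≡ᵇ-refl y)) y≢ᵇy)

  filterᵇ-≡ᵇ : (z : A) (xs : List A) → filterᵇ (_≡ᵇ z) xs ≡ replicate (countᵇ (_≡ᵇ z) xs) z
  filterᵇ-≡ᵇ z [] = refl
  filterᵇ-≡ᵇ z (y ∷ xs) with y ≟ z
  ... | yes refl = cong (y ∷_) (filterᵇ-≡ᵇ z xs)
  ... | no _ = filterᵇ-≡ᵇ z xs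

  ∑-≡ᵇ-∧ : (e : A) (f : A → Bool) (T : List A) → ∑ (λ x → 𝟙 (x ≡ᵇ e ∧ f x)) T ≡ countᵇ (_≡ᵇ e) T * 𝟙 (f e)
  ∑-≡ᵇ-∧ e f [] = refl
  ∑-≡ᵇ-∧ e f (x ∷ T) with x ≟ e
  ... | yes refl = cong (𝟙 (f x) +_) (∑-≡ᵇ-∧ e f T)
  ... | no _ = ∑-≡ᵇ-∧ e f T

  once-disjoint : (p q : List A) → Once (p ++ q) → {y : A} → y ∈ p → y ∈ q → ⊥
  once-disjoint p q once {y} y∈p y∈q = ℕ.<-irrefl refl (subst (2 ≤_) count-y
    (ℕ.+-mono-≤ (countᵇ-pos (_≡ᵇ y) y∈p (≡ᵇ-refl y)) (countᵇ-pos (_≡ᵇ y) y∈q (≡ᵇ-refl y))))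
    where
      count-y : countᵇ (_≡ᵇ y) p + countᵇ (_≡ᵇ y) q ≡ 1
      count-y = ≡-trans (sym (∑-++ (𝟙 ∘ (_≡ᵇ y)) p q)) (once y)

  first-occurrence : {x : A} {p : List A} → x ∈ p → ∃₂ λ p₁ p₂ → p ≡ p₁ ++ x ∷ p₂ × x ∉ p₁
  first-occurrence {x} {z ∷ p} x∈p with z ≟ x
  ... | yes refl = [] , p , refl , λ ()
  first-occurrence {x} {z ∷ p} (here refl) | no z≢x = ⊥-elim (z≢x refl)
  first-occurrence {x} {z ∷ p} (there x∈p) | no z≢x with first-occurrence x∈p
  ... | p₁ , p₂ , refl , x∉p₁ = z ∷ p₁ , p₂ , refl , λ { (here x≡z) → z≢x (sym x≡z) ; (there x∈p₁) → x∉p₁ x∈p₁ }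

  module _ (P : A → Bool) where

    noneOf-∈ : {y : A} {xs : List A} → noneOf P xs ≡ true → y ∈ xs → P y ≡ false
    noneOf-∈ {xs = z ∷ xs} none (here refl) with P z
    ... | false = refl
    noneOf-∈ {xs = z ∷ xs} none (there y∈xs) with P z
    ... | false = noneOf-∈ none y∈xs

    noneOf-false : {y : A} {xs : List A} → y ∈ xs → P y ≡ true → noneOf P xs ≡ false
    noneOf-false (here refl) Py rewrite Py = refl
    noneOf-false {xs = z ∷ xs} (there y∈xs) Py = ≡-trans (cong (not (P z) ∧_) (noneOf-false y∈xs Py)) (𝔹.∧-zeroʳ _)

    noneOf-false⁻ : (xs : List A) → noneOf P xs ≡ false → Any (λ y → P y ≡ true) xs
    noneOf-false⁻ (z ∷ xs) some with P z in Pz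
    ... | true = here Pz
    ... | false = there (noneOf-false⁻ xs some)

    last-occurrence : (ω : List A) → Any (λ y → P y ≡ true) ω →
      ∃₂ λ p e → ∃ λ q → ω ≡ p ++ e ∷ q × P e ≡ true × noneOf P q ≡ true
    last-occurrence (z ∷ zs) has with noneOf P zs in none-after-z
    last-occurrence (z ∷ zs) (here Pz) | true = [] , z , zs , refl , Pz , none-after-z
    last-occurrence (z ∷ zs) (there has) | true with find has
    ... | y , y∈zs , Py = ⊥-elim (true≢false (≡-trans (sym none-after-z) (noneOf-false y∈zs Py)))
    last-occurrence (z ∷ zs) has | false with last-occurrence zs (noneOf-false⁻ zs none-after-z)
    ... | p , e , q , refl , Pe , none = z ∷ p , e , q , refl , Pe , none

  module _ (x : A) (P : A → Bool) where

    noneAfter-split : (p₁ s : List A) → x ∉ p₁ → noneAfter x P (p₁ ++ x ∷ s) ≡ noneOf P s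
    noneAfter-split [] s _ = noneAfter-here x P s
    noneAfter-split (z ∷ p₁) s x∉ = ≡-trans (noneAfter-there x P (λ z≡x → x∉ (here (sym z≡x))) (p₁ ++ x ∷ s))
                                           (noneAfter-split p₁ s (x∉ ∘ there))

    noneBefore-split : (p₁ s : List A) → x ∉ p₁ → noneBefore x P (p₁ ++ x ∷ s) ≡ noneOf P p₁
    noneBefore-split [] s _ = noneBefore-here x P s
    noneBefore-split (z ∷ p₁) s x∉ = ≡-trans (noneBefore-there x P (λ z≡x → x∉ (here (sym z≡x))) (p₁ ++ x ∷ s))
                                            (cong (not (P z) ∧_) (noneBefore-split p₁ s (x∉ ∘ there)))

∃ᵇ ∀ᵇ : {m : ℕ} → (Fin m → Bool) → Bool
∃ᵇ {zero} f = false
∃ᵇ {suc m} f = f Fin.zero ∨ ∃ᵇ (f ∘ Fin.suc)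
∀ᵇ {zero} f = true
∀ᵇ {suc m} f = f Fin.zero ∧ ∀ᵇ (f ∘ Fin.suc)

∃ᵇ-cong : {m : ℕ} {f g : Fin m → Bool} → (∀ i → f i ≡ g i) → ∃ᵇ f ≡ ∃ᵇ g
∃ᵇ-cong {zero} e = refl
∃ᵇ-cong {suc m} e = cong₂ _∨_ (e Fin.zero) (∃ᵇ-cong (e ∘ Fin.suc))

∃ᵇ-intro : {m : ℕ} (f : Fin m → Bool) (i : Fin m) → f i ≡ true → ∃ᵇ f ≡ true
∃ᵇ-intro f Fin.zero fi rewrite fi = refl
∃ᵇ-intro f (Fin.suc i) fi = ≡-trans (cong (f Fin.zero ∨_) (∃ᵇ-intro (f ∘ Fin.suc) i fi)) (𝔹.∨-zeroʳ _)

∃ᵇ-elim : {m : ℕ} (f : Fin m → Bool) → ∃ᵇ f ≡ true → ∃ λ i → f i ≡ true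
∃ᵇ-elim {suc m} f some with f Fin.zero in f0
... | true = Fin.zero , f0
... | false with ∃ᵇ-elim (f ∘ Fin.suc) some
...   | i , fi = Fin.suc i , fi

∀ᵇ-intro : {m : ℕ} (f : Fin m → Bool) → (∀ i → f i ≡ true) → ∀ᵇ f ≡ true
∀ᵇ-intro {zero} f _ = refl
∀ᵇ-intro {suc m} f all rewrite all Fin.zero = ∀ᵇ-intro (f ∘ Fin.suc) (all ∘ Fin.suc)

∀ᵇ-elim : {m : ℕ} (f : Fin m → Bool) → ∀ᵇ f ≡ true → ∀ i → f i ≡ true
∀ᵇ-elim f all i with f i in fi
... | true = refl
... | false = ⊥-elim (true≢false (≡-trans (sym all) (∀ᵇ-false f i fi)))
  where
    ∀ᵇ-false : {m : ℕ} (f : Fin m → Bool) (i : Fin m) → f i ≡ false → ∀ᵇ f ≡ false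
    ∀ᵇ-false f Fin.zero fi rewrite fi = refl
    ∀ᵇ-false f (Fin.suc i) fi = ≡-trans (cong (f Fin.zero ∧_) (∀ᵇ-false (f ∘ Fin.suc) i fi)) (𝔹.∧-zeroʳ _)

∀ᵇ-false⁻ : {m : ℕ} (f : Fin m → Bool) → ∀ᵇ f ≡ false → ∃ λ i → f i ≡ false
∀ᵇ-false⁻ {suc m} f some with f Fin.zero in f0
... | false = Fin.zero , f0
... | true with ∀ᵇ-false⁻ (f ∘ Fin.suc) some
...   | i , fi = Fin.suc i , fi

not-∃ᵇ : {m : ℕ} (f : Fin m → Bool) → not (∃ᵇ f) ≡ ∀ᵇ (not ∘ f)
not-∃ᵇ {zero} f = refl
not-∃ᵇ {suc m} f with f Fin.zero
... | true = refl
... | false = not-∃ᵇ (f ∘ Fin.suc)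

¬∃ᵇ-∧-∀ᵇ : {m : ℕ} (σ h b : Fin m → Bool) →
  not (∃ᵇ (λ i → σ i ∧ h i)) ∧ ∀ᵇ (λ i → not (σ i) ∨ b i) ≡ ∀ᵇ (λ i → not (σ i) ∨ (not (h i) ∧ b i))
¬∃ᵇ-∧-∀ᵇ {zero} σ h b = refl
¬∃ᵇ-∧-∀ᵇ {suc m} σ h b with σ Fin.zero | h Fin.zero | b Fin.zero
... | false | _ | _ = ¬∃ᵇ-∧-∀ᵇ (σ ∘ Fin.suc) (h ∘ Fin.suc) (b ∘ Fin.suc)
... | true | true | _ = refl
... | true | false | false = 𝔹.∧-zeroʳ _
... | true | false | true = ¬∃ᵇ-∧-∀ᵇ (σ ∘ Fin.suc) (h ∘ Fin.suc) (b ∘ Fin.suc)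

∏ : {m : ℕ} → (Fin m → ℕ) → ℕ
∏ {zero} f = 1
∏ {suc m} f = f Fin.zero * ∏ (f ∘ Fin.suc)

∏-cong : {m : ℕ} {f g : Fin m → ℕ} → (∀ i → f i ≡ g i) → ∏ f ≡ ∏ g
∏-cong {zero} e = refl
∏-cong {suc m} e = cong₂ _*_ (e Fin.zero) (∏-cong (e ∘ Fin.suc))

∏-const : (m c : ℕ) → ∏ {m} (λ _ → c) ≡ c ^ m
∏-const zero c = refl
∏-const (suc m) c = cong (c *_) (∏-const m c)

popcount : {m : ℕ} → (Fin m → Bool) → ℕ
popcount {zero} σ = 0
popcount {suc m} σ = 𝟙 (σ Fin.zero) + popcount (σ ∘ Fin.suc)

popcount-∅ : {m : ℕ} → popcount {m} (λ _ → false) ≡ 0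
popcount-∅ {zero} = refl
popcount-∅ {suc m} = popcount-∅ {m}

popcount-≤ : {m : ℕ} (σ : Fin m → Bool) → popcount σ ≤ m
popcount-≤ {zero} σ = z≤n
popcount-≤ {suc m} σ with σ Fin.zero
... | true = s≤s (popcount-≤ (σ ∘ Fin.suc))
... | false = ℕ.m≤n⇒m≤1+n (popcount-≤ (σ ∘ Fin.suc))

∏-if : {m : ℕ} (σ : Fin m → Bool) (a b : ℕ) →
       ∏ (λ i → if σ i then a else b) ≡ a ^ popcount σ * b ^ (m ∸ popcount σ)
∏-if {zero} σ a b = refl
∏-if {suc m} σ a b with σ Fin.zero
... | true = ≡-trans (cong (a *_) (∏-if (σ ∘ Fin.suc) a b)) (sym (ℕ.*-assoc a _ _))
... | false = begin
    b * ∏ (λ i → if σ (Fin.suc i) then a else b) ≡⟨ cong (b *_) (∏-if (σ ∘ Fin.suc) a b) ⟩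
    b * (a ^ k * b ^ (m ∸ k))   ≡⟨ ℕ.*-comm b _ ⟩
    (a ^ k * b ^ (m ∸ k)) * b   ≡⟨ ℕ.*-assoc (a ^ k) _ b ⟩
    a ^ k * (b ^ (m ∸ k) * b)   ≡⟨ cong (a ^ k *_) (ℕ.*-comm _ b) ⟩
    a ^ k * b ^ suc (m ∸ k)     ≡⟨ cong (λ e → a ^ k * b ^ e) (ℕ.+-∸-assoc 1 (popcount-≤ (σ ∘ Fin.suc))) ⟨
    a ^ k * b ^ (suc m ∸ k)     ∎
  where
    open ≡-Reasoning
    k = popcount (σ ∘ Fin.suc)

∃ᵇ-false⇒popcount≡0 : {m : ℕ} (σ : Fin m → Bool) → ∃ᵇ σ ≡ false → popcount σ ≡ 0
∃ᵇ-false⇒popcount≡0 {zero} σ _ = refl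
∃ᵇ-false⇒popcount≡0 {suc m} σ none with σ Fin.zero
... | false = ∃ᵇ-false⇒popcount≡0 (σ ∘ Fin.suc) none

∑-allFin : {m : ℕ} (f : Fin (suc m) → ℕ) → ∑ f (allFin (suc m)) ≡ f Fin.zero + ∑ (f ∘ Fin.suc) (allFin m)
∑-allFin {m} f = cong (f Fin.zero +_)
  (≡-trans (cong (∑ f) (sym (List.map-tabulate (λ i → i) Fin.suc))) (∑-map f Fin.suc (allFin m)))

countᵇ-allFin-true : (n : ℕ) → countᵇ (λ _ → true) (allFin n) ≡ n
countᵇ-allFin-true n = ≡-trans (∑-ones (allFin n)) (List.length-tabulate (λ i → i))

countᵇ-allFin-≡ : {n : ℕ} (a : Fin n) → countᵇ (_≡ᵇᶠ a) (allFin n) ≡ 1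
countᵇ-allFin-≡ {suc n} Fin.zero = ≡-trans (∑-allFin {n} (𝟙 ∘ (_≡ᵇᶠ Fin.zero))) (cong suc (∑-zero (allFin n)))
countᵇ-allFin-≡ {suc n} (Fin.suc a) = ≡-trans (∑-allFin {n} (𝟙 ∘ (_≡ᵇᶠ Fin.suc a))) (countᵇ-allFin-≡ a)

countᵇ-allFin-≢ : {n : ℕ} (a : Fin n) → countᵇ (λ v → not (v ≡ᵇᶠ a)) (allFin n) ≡ n ∸ 1
countᵇ-allFin-≢ {n} a = begin
    countᵇ (λ v → not (v ≡ᵇᶠ a)) (allFin n)
  ≡⟨ ℕ.m+n∸m≡n 1 _ ⟨
    1 + countᵇ (λ v → not (v ≡ᵇᶠ a)) (allFin n) ∸ 1
  ≡⟨ cong (λ k → k + countᵇ (λ v → not (v ≡ᵇᶠ a)) (allFin n) ∸ 1) (countᵇ-allFin-≡ a) ⟨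
    countᵇ (_≡ᵇᶠ a) (allFin n) + countᵇ (λ v → not (v ≡ᵇᶠ a)) (allFin n) ∸ 1
  ≡⟨ cong (_∸ 1) (countᵇ-split (λ _ → true) (_≡ᵇᶠ a) (allFin n)) ⟨
    countᵇ (λ _ → true) (allFin n) ∸ 1
  ≡⟨ cong (_∸ 1) (countᵇ-allFin-true n) ⟩
    n ∸ 1 ∎
  where open ≡-Reasoning

count-allVecs-∀ᵇ : (m n : ℕ) (Q : Fin m → Fin n → Bool) →
  countᵇ (λ w → ∀ᵇ (λ i → Q i (lookup w i))) (allVecs m n) ≡ ∏ (λ i → countᵇ (Q i) (allFin n))
count-allVecs-∀ᵇ zero n Q = refl
count-allVecs-∀ᵇ (suc m) n Q = begin
    ∑ F (concatMap (λ v → map (v ∷ᵛ_) (allVecs m n)) (allFin n))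
  ≡⟨ ∑-concatMap F (λ v → map (v ∷ᵛ_) (allVecs m n)) (allFin n) ⟩
    ∑ (λ v → ∑ F (map (v ∷ᵛ_) (allVecs m n))) (allFin n)
  ≡⟨ ∑-cong (λ v → ≡-trans (∑-map F (v ∷ᵛ_) (allVecs m n)) (∑-cong (λ w → 𝟙-∧ (Q Fin.zero v) _) (allVecs m n))) (allFin n) ⟩
    ∑ (λ v → ∑ (λ w → 𝟙 (Q Fin.zero v) * 𝟙 (rest w)) (allVecs m n)) (allFin n)
  ≡⟨ ∑-cong (λ v → ∑-*ˡ (𝟙 (Q Fin.zero v)) (𝟙 ∘ rest) (allVecs m n)) (allFin n) ⟩
    ∑ (λ v → 𝟙 (Q Fin.zero v) * countᵇ rest (allVecs m n)) (allFin n)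
  ≡⟨ ∑-cong (λ v → ℕ.*-comm (𝟙 (Q Fin.zero v)) _) (allFin n) ⟩
    ∑ (λ v → countᵇ rest (allVecs m n) * 𝟙 (Q Fin.zero v)) (allFin n)
  ≡⟨ ∑-*ˡ (countᵇ rest (allVecs m n)) (𝟙 ∘ Q Fin.zero) (allFin n) ⟩
    countᵇ rest (allVecs m n) * countᵇ (Q Fin.zero) (allFin n)
  ≡⟨ ℕ.*-comm _ (countᵇ (Q Fin.zero) (allFin n)) ⟩
    countᵇ (Q Fin.zero) (allFin n) * countᵇ rest (allVecs m n)
  ≡⟨ cong (countᵇ (Q Fin.zero) (allFin n) *_) (count-allVecs-∀ᵇ m n (Q ∘ Fin.suc)) ⟩
    ∏ (λ i → countᵇ (Q i) (allFin n)) ∎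
  where
    open ≡-Reasoning
    F : Vec (Fin n) (suc m) → ℕ
    F w = 𝟙 (∀ᵇ (λ i → Q i (lookup w i)))
    rest : Vec (Fin n) m → Bool
    rest w = ∀ᵇ (λ i → Q (Fin.suc i) (lookup w i))
    𝟙-∧ : (a b : Bool) → 𝟙 (a ∧ b) ≡ 𝟙 a * 𝟙 b
    𝟙-∧ true b = sym (ℕ.+-identityʳ _)
    𝟙-∧ false b = refl

length-filter : {A : Set} {P : A → Set} (P? : (y : A) → Dec (P y)) (xs : List A) →
                length (filter P? xs) ≡ countᵇ (does ∘ P?) xs
length-filter P? [] = refl
length-filter P? (x ∷ xs) with does (P? x)
... | true = cong suc (length-filter P? xs)
... | false = length-filter P? xs

module _ {A : Set} where

  filterᵇ-All : (P : A → Bool) (xs : List A) → All (λ y → P y ≡ true) (filterᵇ P xs)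
  filterᵇ-All P [] = []
  filterᵇ-All P (x ∷ xs) with P x in Px
  ... | true = Px ∷ filterᵇ-All P xs
  ... | false = filterᵇ-All P xs

  length-filterᵇ : (P : A → Bool) (xs : List A) → length (filterᵇ P xs) ≡ countᵇ P xs
  length-filterᵇ P = length-filter (T? ∘ P)

  module _ (P Q R : A → Bool) (P⇒¬Q : ∀ y → P y ≡ true → Q y ≡ false)
           (P⇒¬R : ∀ y → P y ≡ true → R y ≡ false) (Q⇒¬R : ∀ y → Q y ≡ true → R y ≡ false) where

    partition₄-↭ : (xs : List A) →
      xs ↭ filterᵇ (λ y → not (P y ∨ Q y ∨ R y)) xs ++ filterᵇ P xs ++ filterᵇ Q xs ++ filterᵇ R xs
    partition₄-↭ [] = refl
    partition₄-↭ (x ∷ xs) with P x in Px | Q x in Qx | R x in Rx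
    ... | true  | true  | _     = ⊥-elim (true≢false (≡-trans (sym Qx) (P⇒¬Q x Px)))
    ... | true  | false | true  = ⊥-elim (true≢false (≡-trans (sym Rx) (P⇒¬R x Px)))
    ... | false | true  | true  = ⊥-elim (true≢false (≡-trans (sym Rx) (Q⇒¬R x Qx)))
    ... | false | false | false = prep x (partition₄-↭ xs)
    ... | true  | false | false = ↭-trans (prep x (partition₄-↭ xs)) (↭-sym (shift x (filterᵇ (λ y → not (P y ∨ Q y ∨ R y)) xs) _))
    ... | false | true  | false = ↭-trans (prep x (partition₄-↭ xs)) (↭-trans (↭-sym (shift x (filterᵇ (λ y → not (P y ∨ Q y ∨ R y)) xs) _))
          (++⁺ˡ (filterᵇ (λ y → not (P y ∨ Q y ∨ R y)) xs) (↭-sym (shift x (filterᵇ P xs) _))))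
    ... | false | false | true  = ↭-trans (prep x (partition₄-↭ xs)) (↭-trans (↭-sym (shift x (filterᵇ (λ y → not (P y ∨ Q y ∨ R y)) xs) _))
          (++⁺ˡ (filterᵇ (λ y → not (P y ∨ Q y ∨ R y)) xs) (↭-trans (↭-sym (shift x (filterᵇ P xs) _))
            (++⁺ˡ (filterᵇ P xs) (↭-sym (shift x (filterᵇ Q xs) _))))))

module _ {A : Set} where

  ∑-subsets-∷ : (F : List A → ℕ) (x : A) (xs : List A) →
                ∑ F (subsets (x ∷ xs)) ≡ ∑ F (subsets xs) + ∑ (F ∘ (x ∷_)) (subsets xs)
  ∑-subsets-∷ F x xs = ≡-trans (∑-++ F (subsets xs) (map (x ∷_) (subsets xs)))
                               (cong (∑ F (subsets xs) +_) (∑-map F (x ∷_) (subsets xs)))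

  ∑-subsets-↭ : (F : List A → ℕ) → (∀ {s t} → s ↭ t → F s ≡ F t) →
                {xs ys : List A} → xs ↭ ys → ∑ F (subsets xs) ≡ ∑ F (subsets ys)
  ∑-subsets-↭ F F-resp refl = refl
  ∑-subsets-↭ F F-resp {x ∷ xs} {x ∷ ys} (prep x p) = begin
      ∑ F (subsets (x ∷ xs))
    ≡⟨ ∑-subsets-∷ F x xs ⟩
      ∑ F (subsets xs) + ∑ (F ∘ (x ∷_)) (subsets xs)
    ≡⟨ cong₂ _+_ (∑-subsets-↭ F F-resp p) (∑-subsets-↭ (F ∘ (x ∷_)) (F-resp ∘ prep x) p) ⟩
      ∑ F (subsets ys) + ∑ (F ∘ (x ∷_)) (subsets ys)
    ≡⟨ ∑-subsets-∷ F x ys ⟨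
      ∑ F (subsets (x ∷ ys)) ∎
    where open ≡-Reasoning
  ∑-subsets-↭ F F-resp {x ∷ y ∷ xs} {y ∷ x ∷ ys} (swap x y p) = begin
      ∑ F (subsets (x ∷ y ∷ xs))
    ≡⟨ ≡-trans (∑-subsets-∷ F x (y ∷ xs)) (cong₂ _+_ (∑-subsets-∷ F y xs) (∑-subsets-∷ (F ∘ (x ∷_)) y xs)) ⟩
      (Σ[ F ] xs + Σ[ F ∘ (y ∷_) ] xs) + (Σ[ F ∘ (x ∷_) ] xs + Σ[ F ∘ (λ s → x ∷ y ∷ s) ] xs)
    ≡⟨ cong₂ _+_ (cong₂ _+_ (∑-subsets-↭ F F-resp p) (∑-subsets-↭ (F ∘ (y ∷_)) (F-resp ∘ prep y) p))
                 (cong₂ _+_ (∑-subsets-↭ (F ∘ (x ∷_)) (F-resp ∘ prep x) p)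
                            (≡-trans (∑-cong (λ s → F-resp (swap x y refl)) (subsets xs))
                                     (∑-subsets-↭ (F ∘ (λ s → y ∷ x ∷ s)) (λ q → F-resp (prep y (prep x q))) p))) ⟩
      (Σ[ F ] ys + Σ[ F ∘ (y ∷_) ] ys) + (Σ[ F ∘ (x ∷_) ] ys + Σ[ F ∘ (λ s → y ∷ x ∷ s) ] ys)
    ≡⟨ +-interchange (Σ[ F ] ys) (Σ[ F ∘ (y ∷_) ] ys) (Σ[ F ∘ (x ∷_) ] ys) (Σ[ F ∘ (λ s → y ∷ x ∷ s) ] ys) ⟩
      (Σ[ F ] ys + Σ[ F ∘ (x ∷_) ] ys) + (Σ[ F ∘ (y ∷_) ] ys + Σ[ F ∘ (λ s → y ∷ x ∷ s) ] ys)
    ≡⟨ ≡-trans (∑-subsets-∷ F y (x ∷ ys)) (cong₂ _+_ (∑-subsets-∷ F x ys) (∑-subsets-∷ (F ∘ (y ∷_)) x ys)) ⟨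
      ∑ F (subsets (y ∷ x ∷ ys)) ∎
    where
      open ≡-Reasoning
      Σ[_]_ : (List A → ℕ) → List A → ℕ
      Σ[ G ] zs = ∑ G (subsets zs)
  ∑-subsets-↭ F F-resp (trans p q) = ≡-trans (∑-subsets-↭ F F-resp p) (∑-subsets-↭ F F-resp q)

  ∑-subsets-++ : (F : List A → ℕ) (xs ys : List A) →
                 ∑ F (subsets (xs ++ ys)) ≡ ∑ (λ s → ∑ (λ t → F (s ++ t)) (subsets ys)) (subsets xs)
  ∑-subsets-++ F [] ys = sym (ℕ.+-identityʳ _)
  ∑-subsets-++ F (x ∷ xs) ys = begin
      ∑ F (subsets (x ∷ xs ++ ys))
    ≡⟨ ∑-subsets-∷ F x (xs ++ ys) ⟩
      ∑ F (subsets (xs ++ ys)) + ∑ (F ∘ (x ∷_)) (subsets (xs ++ ys))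
    ≡⟨ cong₂ _+_ (∑-subsets-++ F xs ys) (∑-subsets-++ (F ∘ (x ∷_)) xs ys) ⟩
      ∑ (λ s → ∑ (λ t → F (s ++ t)) (subsets ys)) (subsets xs) + ∑ (λ s → ∑ (λ t → F (x ∷ s ++ t)) (subsets ys)) (subsets xs)
    ≡⟨ ∑-subsets-∷ (λ s → ∑ (λ t → F (s ++ t)) (subsets ys)) x xs ⟨
      ∑ (λ s → ∑ (λ t → F (s ++ t)) (subsets ys)) (subsets (x ∷ xs)) ∎
    where open ≡-Reasoning

  ∑-subsets-only-[] : (g : List A → ℕ) (ys : List A) → (∀ {y} t → y ∈ ys → g (y ∷ t) ≡ 0) →
                      ∑ g (subsets ys) ≡ g []
  ∑-subsets-only-[] g [] _ = ℕ.+-identityʳ (g [])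
  ∑-subsets-only-[] g (y ∷ ys) g≡0 = begin
      ∑ g (subsets (y ∷ ys))
    ≡⟨ ∑-subsets-∷ g y ys ⟩
      ∑ g (subsets ys) + ∑ (g ∘ (y ∷_)) (subsets ys)
    ≡⟨ cong₂ _+_ (∑-subsets-only-[] g ys (λ t → g≡0 t ∘ there))
                 (≡-trans (∑-cong (λ t → g≡0 t (here refl)) (subsets ys)) (∑-zero (subsets ys))) ⟩
      g [] + 0
    ≡⟨ ℕ.+-identityʳ (g []) ⟩
      g [] ∎
    where open ≡-Reasoning

  ∑-subsets-singletons : (g : List A → ℕ) (X : List A) → g [] ≡ 0 →
                         (∀ {x y} t → x ∈ X → y ∈ X → g (x ∷ y ∷ t) ≡ 0) →
                         ∑ g (subsets X) ≡ ∑ (λ x → g [ x ]) X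
  ∑-subsets-singletons g [] g[]≡0 _ = ≡-trans (ℕ.+-identityʳ (g [])) g[]≡0
  ∑-subsets-singletons g (x ∷ X) g[]≡0 g₂≡0 = begin
      ∑ g (subsets (x ∷ X))
    ≡⟨ ∑-subsets-∷ g x X ⟩
      ∑ g (subsets X) + ∑ (g ∘ (x ∷_)) (subsets X)
    ≡⟨ cong₂ _+_ (∑-subsets-singletons g X g[]≡0 (λ t x∈ y∈ → g₂≡0 t (there x∈) (there y∈)))
                 (∑-subsets-only-[] (g ∘ (x ∷_)) X (λ t y∈X → g₂≡0 t (here refl) (there y∈X))) ⟩
      ∑ (λ x → g [ x ]) X + g [ x ]
    ≡⟨ ℕ.+-comm _ (g [ x ]) ⟩
      ∑ (λ x → g [ x ]) (x ∷ X) ∎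
    where open ≡-Reasoning

  subsets-⊆ : (xs : List A) → All (_⊆ xs) (subsets xs)
  subsets-⊆ [] = (λ ()) ∷ []
  subsets-⊆ (x ∷ xs) = All.++⁺ (All.map (λ s⊆xs {y} y∈s → there (s⊆xs y∈s)) (subsets-⊆ xs))
    (All.map⁺ (All.map (λ s⊆xs {y} → λ { (here y≡x) → here y≡x ; (there y∈s) → there (s⊆xs y∈s) }) (subsets-⊆ xs)))

∈-allVecs : (m n : ℕ) (y : Vec (Fin n) m) → y ∈ allVecs m n
∈-allVecs zero n Vec.[] = here refl
∈-allVecs (suc m) n (a ∷ᵛ y) = ∈-concatMap⁺ (λ v → map (v ∷ᵛ_) (allVecs m n)) (lose (∈-allFin a) (∈-map⁺ (a ∷ᵛ_) (∈-allVecs m n y)))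

module Hypergraph (r n : ℕ) where

  E : Set
  E = Edge r n

  _≟ᴱ_ : DecidableEquality E
  _≟ᴱ_ = Vec.≡-dec _≟ᶠ_

  open Orderings _≟ᴱ_ public
  open import Data.List.Membership.DecPropositional _≟ᴱ_ using (_∈?_)

  edges : List E
  edges = allEdges r n

  meets : Fin r → E → E → Bool
  meets i x y = lookup y i ≡ᵇᶠ lookup x i

  ≡ᵇ-lookup : {m : ℕ} (y z : Vec (Fin n) m) → does (Vec.≡-dec _≟ᶠ_ y z) ≡ ∀ᵇ (λ i → lookup y i ≡ᵇᶠ lookup z i)
  ≡ᵇ-lookup Vec.[] Vec.[] = refl
  ≡ᵇ-lookup (a ∷ᵛ y) (b ∷ᵛ z) = cong (a ≡ᵇᶠ b ∧_) (≡ᵇ-lookup y z)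

  once-edges : Once edges
  once-edges z = begin
      countᵇ (_≡ᵇ z) edges
    ≡⟨ countᵇ-cong (λ y → ≡ᵇ-lookup y z) edges ⟩
      countᵇ (λ y → ∀ᵇ (λ i → lookup y i ≡ᵇᶠ lookup z i)) edges
    ≡⟨ count-allVecs-∀ᵇ r n (λ i v → v ≡ᵇᶠ lookup z i) ⟩
      ∏ (λ i → countᵇ (_≡ᵇᶠ lookup z i) (allFin n))
    ≡⟨ ∏-cong (λ i → countᵇ-allFin-≡ (lookup z i)) ⟩
      ∏ {r} (λ _ → 1)
    ≡⟨ ≡-trans (∏-const r 1) (ℕ.^-zeroˡ r) ⟩
      1 ∎
    where open ≡-Reasoning

  module _ {ω : List E} (ω↭edges : ω ↭ edges) where

    once-↭ : Once ω
    once-↭ z = ≡-trans (∑-↭ (𝟙 ∘ (_≡ᵇ z)) ω↭edges) (once-edges z)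

    ∈-↭ : ∀ y → y ∈ ω
    ∈-↭ y = ↭.∈-resp-↭ (↭-sym ω↭edges) (∈-allVecs r n y)

  length-edges : length edges ≡ n ^ r
  length-edges = begin
      length edges
    ≡⟨ ∑-ones edges ⟨
      countᵇ (λ _ → true) edges
    ≡⟨ countᵇ-cong (λ _ → sym (∀ᵇ-intro {r} (λ _ → true) (λ _ → refl))) edges ⟩
      countᵇ (λ y → ∀ᵇ {r} (λ _ → true)) edges
    ≡⟨ count-allVecs-∀ᵇ r n (λ _ _ → true) ⟩
      ∏ {r} (λ _ → countᵇ (λ _ → true) (allFin n))
    ≡⟨ ≡-trans (∏-cong {r} (λ _ → countᵇ-allFin-true n)) (∏-const r n) ⟩
      n ^ r ∎
    where open ≡-Reasoning

  _∈ᵇ_ : E → List E → Bool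
  y ∈ᵇ T = does (y ∈? T)

  others : List E → E → E → Bool
  others T x y = y ∈ᵇ T ∧ not (y ≡ᵇ x)

  fresh : List E → E → Bool
  fresh ω x = ∃ᵇ (λ i → noneBefore x (meets i x) ω)

  _⊆?_ : (T H : List E) → Dec (All (_∈ H) T)
  T ⊆? H = All.all? (_∈? H) T

  meetsIn : (Fin r → Bool) → E → E → Bool
  meetsIn σ x y = ∃ᵇ (λ i → σ i ∧ meets i x y)

  neighbours : (Fin r → Bool) → E → E → Bool
  neighbours σ x y = meetsIn σ x y ∧ not (y ≡ᵇ x)

  meeting : ℕ → ℕ
  meeting k = n ^ r ∸ (n ∸ 1) ^ k * n ^ (r ∸ k)

  countᵇ-avoiding : (σ : Fin r → Bool) (x : E) →
    countᵇ (not ∘ meetsIn σ x) edges ≡ (n ∸ 1) ^ popcount σ * n ^ (r ∸ popcount σ)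
  countᵇ-avoiding σ x = begin
      countᵇ (not ∘ meetsIn σ x) edges
    ≡⟨ countᵇ-cong (λ y → not-∃ᵇ (λ i → σ i ∧ meets i x y)) edges ⟩
      countᵇ (λ y → ∀ᵇ (λ i → not (σ i ∧ meets i x y))) edges
    ≡⟨ count-allVecs-∀ᵇ r n (λ i v → not (σ i ∧ v ≡ᵇᶠ lookup x i)) ⟩
      ∏ (λ i → countᵇ (λ v → not (σ i ∧ v ≡ᵇᶠ lookup x i)) (allFin n))
    ≡⟨ ∏-cong per-part ⟩
      ∏ (λ i → if σ i then n ∸ 1 else n)
    ≡⟨ ∏-if σ (n ∸ 1) n ⟩
      (n ∸ 1) ^ popcount σ * n ^ (r ∸ popcount σ) ∎
    where
      open ≡-Reasoning
      per-part : ∀ i → countᵇ (λ v → not (σ i ∧ v ≡ᵇᶠ lookup x i)) (allFin n) ≡ (if σ i then n ∸ 1 else n)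
      per-part i with σ i
      ... | true = countᵇ-allFin-≢ (lookup x i)
      ... | false = countᵇ-allFin-true n

  countᵇ-meetsIn : (σ : Fin r → Bool) (x : E) → countᵇ (meetsIn σ x) edges ≡ meeting (popcount σ)
  countᵇ-meetsIn σ x = begin
      countᵇ (meetsIn σ x) edges
    ≡⟨ ℕ.m+n∸n≡m _ (countᵇ (not ∘ meetsIn σ x) edges) ⟨
      countᵇ (meetsIn σ x) edges + countᵇ (not ∘ meetsIn σ x) edges ∸ countᵇ (not ∘ meetsIn σ x) edges
    ≡⟨ cong₂ _∸_ (sym (countᵇ-split (λ _ → true) (meetsIn σ x) edges)) (countᵇ-avoiding σ x) ⟩
      countᵇ (λ _ → true) edges ∸ (n ∸ 1) ^ popcount σ * n ^ (r ∸ popcount σ)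
    ≡⟨ cong (_∸ (n ∸ 1) ^ popcount σ * n ^ (r ∸ popcount σ)) (≡-trans (∑-ones edges) length-edges) ⟩
      meeting (popcount σ) ∎
    where open ≡-Reasoning

  countᵇ-neighbours : (σ : Fin r → Bool) (x : E) → countᵇ (neighbours σ x) edges ≡ meeting (popcount σ) ∸ 1
  countᵇ-neighbours σ x = begin
      countᵇ (neighbours σ x) edges
    ≡⟨ ℕ.m+n∸m≡n (𝟙 (∃ᵇ σ)) _ ⟨
      𝟙 (∃ᵇ σ) + countᵇ (neighbours σ x) edges ∸ 𝟙 (∃ᵇ σ)
    ≡⟨ cong (λ k → k + countᵇ (neighbours σ x) edges ∸ 𝟙 (∃ᵇ σ)) count-x ⟨
      countᵇ (λ y → meetsIn σ x y ∧ y ≡ᵇ x) edges + countᵇ (neighbours σ x) edges ∸ 𝟙 (∃ᵇ σ)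
    ≡⟨ cong (_∸ 𝟙 (∃ᵇ σ)) (≡-trans (sym (countᵇ-split (meetsIn σ x) (_≡ᵇ x) edges)) (countᵇ-meetsIn σ x)) ⟩
      meeting (popcount σ) ∸ 𝟙 (∃ᵇ σ)
    ≡⟨ σ-nonempty-or-meeting≡0 (∃ᵇ σ) refl ⟩
      meeting (popcount σ) ∸ 1 ∎
    where
      open ≡-Reasoning
      meets-self : ∀ y → (meetsIn σ x y ∧ y ≡ᵇ x) ≡ (y ≡ᵇ x ∧ ∃ᵇ σ)
      meets-self y with y ≟ᴱ x
      ... | yes refl = ≡-trans (𝔹.∧-identityʳ _)
                         (∃ᵇ-cong (λ i → ≡-trans (cong (σ i ∧_) (≡ᵇᶠ-refl (lookup y i))) (𝔹.∧-identityʳ (σ i))))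
      ... | no _ = 𝔹.∧-zeroʳ _
      count-x : countᵇ (λ y → meetsIn σ x y ∧ y ≡ᵇ x) edges ≡ 𝟙 (∃ᵇ σ)
      count-x = ≡-trans (countᵇ-cong meets-self edges)
        (≡-trans (∑-≡ᵇ-∧ x (λ _ → ∃ᵇ σ) edges) (≡-trans (cong (_* 𝟙 (∃ᵇ σ)) (once-edges x)) (ℕ.+-identityʳ _)))
      -- For σ = ∅ both sides are 0, by truncated subtraction.
      σ-nonempty-or-meeting≡0 : (b : Bool) → ∃ᵇ σ ≡ b → meeting (popcount σ) ∸ 𝟙 (∃ᵇ σ) ≡ meeting (popcount σ) ∸ 1
      σ-nonempty-or-meeting≡0 true σ≢∅ rewrite σ≢∅ = refl
      σ-nonempty-or-meeting≡0 false σ≡∅ rewrite σ≡∅ | ∃ᵇ-false⇒popcount≡0 σ σ≡∅ = ≡-trans meeting0 (cong (_∸ 1) (sym meeting0))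
        where
          meeting0 : meeting 0 ≡ 0
          meeting0 = ≡-trans (cong (n ^ r ∸_) (ℕ.+-identityʳ (n ^ r))) (ℕ.n∸n≡0 (n ^ r))

  covers-mono : {xs ys : List E} → Covers xs → (∀ {y} → y ∈ xs → y ∈ ys) → Covers ys
  covers-mono covers xs⊆ys i v with find (covers i v)
  ... | y , y∈xs , y∋v = lose (xs⊆ys y∈xs) y∋v

  stopFrom-uncovered : (acc p : List E) (e : E) (q : List E) → ¬ Covers (acc ++ p) →
                       stopFrom acc (p ++ e ∷ q) ≡ stopFrom ((acc ++ p) ++ [ e ]) q
  stopFrom-uncovered acc [] e q uncovered with covers? acc
  ... | yes covers = ⊥-elim (uncovered (subst Covers (sym (List.++-identityʳ acc)) covers))
  ... | no _ = cong (λ t → stopFrom (t ++ [ e ]) q) (sym (List.++-identityʳ acc))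
  stopFrom-uncovered acc (z ∷ p) e q uncovered with covers? acc
  ... | yes covers = ⊥-elim (uncovered (covers-mono covers ∈-++⁺ˡ))
  ... | no _ = ≡-trans (stopFrom-uncovered (acc ++ [ z ]) p e q (uncovered ∘ subst Covers (List.++-assoc acc [ z ] p)))
                       (cong (λ t → stopFrom (t ++ [ e ]) q) (List.++-assoc acc [ z ] p))

  stopFrom-covered : (acc p rest : List E) → Covers (acc ++ p) → ∀ {x} → x ∈ stopFrom acc (p ++ rest) → x ∈ acc ++ p
  stopFrom-covered acc [] [] covers x∈ = ∈-++⁺ˡ x∈
  stopFrom-covered acc [] (z ∷ rest) covers x∈ with covers? acc
  ... | yes _ = ∈-++⁺ˡ x∈
  ... | no uncovered = ⊥-elim (uncovered (subst Covers (List.++-identityʳ acc) covers))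
  stopFrom-covered acc (z ∷ p) rest covers x∈ with covers? acc
  ... | yes _ = ∈-++⁺ˡ x∈
  ... | no _ = subst (_ ∈_) (List.++-assoc acc [ z ] p)
                 (stopFrom-covered (acc ++ [ z ]) p rest (subst Covers (sym (List.++-assoc acc [ z ] p)) covers) x∈)

  stopFrom-⊇ : (acc q : List E) → ∀ {x} → x ∈ acc → x ∈ stopFrom acc q
  stopFrom-⊇ acc [] x∈ = x∈
  stopFrom-⊇ acc (z ∷ q) x∈ with covers? acc
  ... | yes _ = x∈
  ... | no _ = stopFrom-⊇ (acc ++ [ z ]) q (∈-++⁺ˡ x∈)

  stopFrom-prefix : (acc ω : List E) → ∃ λ q → acc ++ ω ≡ stopFrom acc ω ++ q
  stopFrom-prefix acc [] = [] , refl
  stopFrom-prefix acc (z ∷ zs) with covers? acc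
  ... | yes _ = z ∷ zs , refl
  ... | no _ with stopFrom-prefix (acc ++ [ z ]) zs
  ...   | q , eq = q , ≡-trans (sym (List.++-assoc acc [ z ] zs)) eq

  ∈ᵇ-true : {y : E} {T : List E} → y ∈ T → y ∈ᵇ T ≡ true
  ∈ᵇ-true {y} {T} = dec-true (y ∈? T)

  ∈ᵇ-true⁻ : {y : E} {T : List E} → y ∈ᵇ T ≡ true → y ∈ T
  ∈ᵇ-true⁻ {y} {T} = does-true⁻ (y ∈? T)

  isMatching-↭ : {S S′ : List E} → S ↭ S′ → IsMatching S → IsMatching S′
  isMatching-↭ S↭S′ S-matching i v =
    ≡-trans (sym (↭-length (↭.filter-↭ (λ e → lookup e i ≟ᶠ v) S↭S′))) (S-matching i v)

  numMatchings-stopped : (ω : List E) → ω ↭ edges →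
    numMatchings (stoppedHypergraph ω) ≡ ∑ (λ S → 𝟙 (does (isMatching? S) ∧ does (S ⊆? stoppedHypergraph ω))) (subsets edges)
  numMatchings-stopped ω ω↭edges with stopFrom-prefix [] ω
  ... | q , ω≡G++q = begin
      length (filter isMatching? (subsets G))
    ≡⟨ length-filter isMatching? (subsets G) ⟩
      countᵇ (does ∘ isMatching?) (subsets G)
    ≡⟨ ∑-cong-All (All.map {P = _⊆ G} (λ {s} s⊆G → sym (≡-trans (∑-subsets-only-[] (λ t → F (s ++ t)) q (outside s))
                                                      (≡-trans (cong F (List.++-identityʳ s)) (inside s s⊆G))))
                           (subsets-⊆ G)) ⟩
      ∑ (λ s → ∑ (λ t → F (s ++ t)) (subsets q)) (subsets G)
    ≡⟨ ∑-subsets-++ F G q ⟨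
      ∑ F (subsets (G ++ q))
    ≡⟨ cong (∑ F ∘ subsets) ω≡G++q ⟨
      ∑ F (subsets ω)
    ≡⟨ ∑-subsets-↭ F F-resp ω↭edges ⟩
      ∑ F (subsets edges) ∎
    where
      open ≡-Reasoning
      G = stoppedHypergraph ω
      F : List E → ℕ
      F S = 𝟙 (does (isMatching? S) ∧ does (S ⊆? G))
      inside : ∀ s → s ⊆ G → F s ≡ 𝟙 (does (isMatching? s))
      inside s s⊆G with s ⊆? G
      ... | yes _ = cong 𝟙 (𝔹.∧-identityʳ _)
      ... | no s⊈G = ⊥-elim (s⊈G (All.tabulate {P = _∈ G} s⊆G))
      outside : ∀ s {y} t → y ∈ q → F (s ++ y ∷ t) ≡ 0
      outside s {y} t y∈q with (s ++ y ∷ t) ⊆? G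
      ... | yes s++y∷t⊆G = ⊥-elim (once-disjoint G q (subst Once ω≡G++q (once-↭ ω↭edges))
                                                   (All.lookup s++y∷t⊆G (∈-++⁺ʳ s (here refl))) y∈q)
      ... | no _ = cong 𝟙 (𝔹.∧-zeroʳ _)
      F-resp : ∀ {S S′} → S ↭ S′ → F S ≡ F S′
      F-resp {S} {S′} S↭S′ = cong₂ (λ a b → 𝟙 (a ∧ b))
        (does-⇔ (mk⇔ (isMatching-↭ S↭S′) (isMatching-↭ (↭-sym S↭S′))) (isMatching? S) (isMatching? S′))
        (does-⇔ (mk⇔ (↭.All-resp-↭ S↭S′) (↭.All-resp-↭ (↭-sym S↭S′))) (S ⊆? G) (S′ ⊆? G))

  noneBefore-neighbours : (σ : Fin r → Bool) (x : E) (ω : List E) → x ∈ ω →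
    noneBefore x (neighbours σ x) ω ≡ ∀ᵇ (λ i → not (σ i) ∨ noneBefore x (meets i x) ω)
  noneBefore-neighbours σ x (z ∷ ω) x∈zω with z ≟ᴱ x
  ... | yes refl = sym (∀ᵇ-intro _ (λ i → 𝔹.∨-zeroʳ (not (σ i))))
  ... | no z≢x with x∈zω
  ...   | here x≡z = ⊥-elim (z≢x (sym x≡z))
  ...   | there x∈ω = begin
      not (meetsIn σ x z ∧ true) ∧ noneBefore x (neighbours σ x) ω
    ≡⟨ cong₂ (λ a b → not a ∧ b) (𝔹.∧-identityʳ _) (noneBefore-neighbours σ x ω x∈ω) ⟩
      not (meetsIn σ x z) ∧ ∀ᵇ (λ i → not (σ i) ∨ noneBefore x (meets i x) ω)
    ≡⟨ ¬∃ᵇ-∧-∀ᵇ σ (λ i → meets i x z) (λ i → noneBefore x (meets i x) ω) ⟩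
      ∀ᵇ (λ i → not (σ i) ∨ (not (meets i x z) ∧ noneBefore x (meets i x) ω)) ∎
    where open ≡-Reasoning

  module Matching {T : List E} (T-matching : IsMatching T) where

    meets-once : (i : Fin r) (x : E) → countᵇ (meets i x) T ≡ 1
    meets-once i x = ≡-trans (sym (length-filter (λ y → lookup y i ≟ᶠ lookup x i) T)) (T-matching i (lookup x i))

    covered : (i : Fin r) (v : Fin n) → ∃ λ t → t ∈ T × lookup t i ≡ v
    covered i v with countᵇ-witness (λ y → lookup y i ≡ᵇᶠ v) T
                       (≡-trans (sym (length-filter (λ y → lookup y i ≟ᶠ v) T)) (T-matching i v))
    ... | t , t∈T , t∋v = t , t∈T , does-true⁻ (lookup t i ≟ᶠ v) t∋v

    once-in : Fin r → {e : E} → e ∈ T → countᵇ (_≡ᵇ e) T ≡ 1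
    once-in i {e} e∈T = ℕ.≤-antisym
      (subst (countᵇ (_≡ᵇ e) T ≤_) (meets-once i e) (countᵇ-mono (_≡ᵇ e) (meets i e) same-meets T))
      (countᵇ-pos (_≡ᵇ e) e∈T (≡ᵇ-refl e))
      where
        same-meets : ∀ y → y ≡ᵇ e ≡ true → meets i e y ≡ true
        same-meets y y≡ᵇe with y ≟ᴱ e
        ... | yes refl = ≡ᵇᶠ-refl (lookup y i)

    meets⇒≡ : (i : Fin r) {x y : E} → x ∈ T → y ∈ T → meets i x y ≡ true → y ≡ x
    meets⇒≡ i {x} {y} x∈T y∈T meet with y ≟ᴱ x
    ... | yes y≡x = y≡x
    ... | no y≢x = ⊥-elim (ℕ.<-irrefl refl (subst (2 ≤_) count-split
          (ℕ.+-mono-≤ (countᵇ-pos _ x∈T (cong₂ _∧_ (≡ᵇᶠ-refl (lookup x i)) (≡ᵇ-refl x)))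
                      (countᵇ-pos _ y∈T (cong₂ _∧_ meet (cong not (dec-false (y ≟ᴱ x) y≢x)))))))
      where
        count-split : countᵇ (λ z → meets i x z ∧ z ≡ᵇ x) T + countᵇ (λ z → meets i x z ∧ not (z ≡ᵇ x)) T ≡ 1
        count-split = ≡-trans (sym (countᵇ-split (meets i x) (_≡ᵇ x) T)) (meets-once i x)

    module LastEdge (p q : List E) (e : E) (e∈T : e ∈ T) (e∉p : e ∉ p)
                    (T⊆p : ∀ {t} → t ∈ T → t ≢ e → t ∈ p) where

      noneAfter-others : noneOf (_∈ᵇ T) q ≡ true → {x : E} → x ∈ T →
                         noneAfter x (others T x) (p ++ e ∷ q) ≡ x ≡ᵇ e
      noneAfter-others q-outside {x} x∈T with x ≟ᴱ e
      ... | yes refl = ≡-trans (noneAfter-split x (others T x) p q e∉p)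
        (noneOf-intro (others T x) {q} (All.tabulate (λ {y} y∈q →
          cong (_∧ not (y ≡ᵇ x)) (noneOf-∈ (_∈ᵇ T) q-outside y∈q))))
      ... | no x≢e with first-occurrence (T⊆p x∈T x≢e)
      ...   | p₁ , p₂ , p≡ , x∉p₁ = begin
          noneAfter x (others T x) (p ++ e ∷ q)
        ≡⟨ cong (λ l → noneAfter x (others T x) (l ++ e ∷ q)) p≡ ⟩
          noneAfter x (others T x) ((p₁ ++ x ∷ p₂) ++ e ∷ q)
        ≡⟨ cong (noneAfter x (others T x)) (List.++-assoc p₁ (x ∷ p₂) (e ∷ q)) ⟩
          noneAfter x (others T x) (p₁ ++ x ∷ p₂ ++ e ∷ q)
        ≡⟨ noneAfter-split x (others T x) p₁ (p₂ ++ e ∷ q) x∉p₁ ⟩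
          noneOf (others T x) (p₂ ++ e ∷ q)
        ≡⟨ noneOf-false (others T x) (∈-++⁺ʳ p₂ (here refl))
             (cong₂ _∧_ (∈ᵇ-true e∈T) (cong not (dec-false (e ≟ᴱ x) (x≢e ∘ sym)))) ⟩
          false ∎
        where open ≡-Reasoning

      stopped⇒uncovered : All (_∈ stoppedHypergraph (p ++ e ∷ q)) T → ¬ Covers p
      stopped⇒uncovered T⊆G covers = e∉p (stopFrom-covered [] p (e ∷ q) covers (All.lookup T⊆G e∈T))

      uncovered⇒stopped : ¬ Covers p → All (_∈ stoppedHypergraph (p ++ e ∷ q)) T
      uncovered⇒stopped uncovered = All.tabulate λ {t} t∈T →
        subst (t ∈_) (sym (stopFrom-uncovered [] p e q uncovered)) (stopFrom-⊇ (p ++ [ e ]) q (in-p∷e t∈T))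
        where
          in-p∷e : ∀ {t} → t ∈ T → t ∈ p ++ [ e ]
          in-p∷e {t} t∈T with t ≟ᴱ e
          ... | yes refl = ∈-++⁺ʳ p (here refl)
          ... | no t≢e = ∈-++⁺ˡ (T⊆p t∈T t≢e)

      missed⇒uncovered : (i : Fin r) → noneOf (meets i e) p ≡ true → ¬ Covers p
      missed⇒uncovered i missed covers with find (covers i (lookup e i))
      ... | y , y∈p , y∋v = true≢false (≡-trans (sym (dec-true (lookup y i ≟ᶠ lookup e i) y∋v))
                                                (noneOf-∈ (meets i e) missed y∈p))

      uncovered⇒missed : ¬ Covers p → ∃ λ i → noneOf (meets i e) p ≡ true
      uncovered⇒missed uncovered = i , noneOf-intro (meets i e) (All.tabulate λ {y} y∈p →
          dec-false (lookup y i ≟ᶠ lookup e i) (λ y∋eᵢ → v-uncovered (lose y∈p (≡-trans y∋eᵢ (sym v≡eᵢ)))))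
        where
          Covered : Fin r → Fin n → Set
          Covered i v = Any (λ y → lookup y i ≡ v) p
          covered? : (i : Fin r) (v : Fin n) → Dec (Covered i v)
          covered? i v = Any.any? (λ y → lookup y i ≟ᶠ v) p
          part-uncovered = Fin.¬∀⟶∃¬ r (λ i → ∀ v → Covered i v) (λ i → Fin.all? (covered? i)) uncovered
          i = proj₁ part-uncovered
          vertex-uncovered = Fin.¬∀⟶∃¬ n (Covered i) (covered? i) (proj₂ part-uncovered)
          v = proj₁ vertex-uncovered
          v-uncovered : ¬ Covered i v
          v-uncovered = proj₂ vertex-uncovered
          v≡eᵢ : v ≡ lookup e i
          v≡eᵢ with covered i v
          ... | t , t∈T , t∋v with t ≟ᴱ e
          ...   | yes refl = sym t∋v
          ...   | no t≢e = ⊥-elim (v-uncovered (lose (T⊆p t∈T t≢e) t∋v))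

      does-⊆-stopped : does (T ⊆? stoppedHypergraph (p ++ e ∷ q)) ≡ fresh (p ++ e ∷ q) e
      does-⊆-stopped = ≡-trans
        (does-≡ (T ⊆? stoppedHypergraph (p ++ e ∷ q))
          (λ T⊆G → let (i , missed) = uncovered⇒missed (stopped⇒uncovered T⊆G) in ∃ᵇ-intro _ i missed)
          (λ some → let (i , missed) = ∃ᵇ-elim _ some in uncovered⇒stopped (missed⇒uncovered i missed)))
        (sym (∃ᵇ-cong (λ i → noneBefore-split e (meets i e) p q e∉p)))

    -- With e the last edge of T in ω, T ⊆ G_ω iff the edges before e do not cover every vertex; as they
    -- include T ∖ {e}, the only vertices they can miss are those of e.
    𝟙-⊆-stopped : Fin r → Fin n → (ω : List E) → Once ω → (∀ y → y ∈ ω) →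
      𝟙 (does (T ⊆? stoppedHypergraph ω)) ≡ ∑ (λ x → 𝟙 (noneAfter x (others T x) ω ∧ fresh ω x)) T
    𝟙-⊆-stopped i₀ v₀ ω once every with covered i₀ v₀
    ... | e₀ , e₀∈T , _ with last-occurrence (_∈ᵇ T) ω (lose (every e₀) (∈ᵇ-true e₀∈T))
    ... | p , e , q , refl , e∈ᵇT , q-outside = begin
        𝟙 (does (T ⊆? stoppedHypergraph (p ++ e ∷ q)))
      ≡⟨ cong 𝟙 does-⊆-stopped ⟩
        𝟙 (fresh (p ++ e ∷ q) e)
      ≡⟨ ℕ.+-identityʳ _ ⟨
        1 * 𝟙 (fresh (p ++ e ∷ q) e)
      ≡⟨ cong (_* 𝟙 (fresh (p ++ e ∷ q) e)) (once-in i₀ e∈T) ⟨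
        countᵇ (_≡ᵇ e) T * 𝟙 (fresh (p ++ e ∷ q) e)
      ≡⟨ ∑-≡ᵇ-∧ e (fresh (p ++ e ∷ q)) T ⟨
        ∑ (λ x → 𝟙 (x ≡ᵇ e ∧ fresh (p ++ e ∷ q) x)) T
      ≡⟨ ∑-cong-All (All.tabulate λ x∈T → cong (λ b → 𝟙 (b ∧ _)) (noneAfter-others q-outside x∈T)) ⟨
        ∑ (λ x → 𝟙 (noneAfter x (others T x) (p ++ e ∷ q) ∧ fresh (p ++ e ∷ q) x)) T ∎
      where
        open ≡-Reasoning
        e∈T : e ∈ T
        e∈T = ∈ᵇ-true⁻ e∈ᵇT
        e∉p : e ∉ p
        e∉p e∈p = once-disjoint p (e ∷ q) once e∈p (here refl)
        T⊆p : ∀ {t} → t ∈ T → t ≢ e → t ∈ p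
        T⊆p {t} t∈T t≢e with ∈-++⁻ p (every t)
        ... | inj₁ t∈p = t∈p
        ... | inj₂ (here t≡e) = ⊥-elim (t≢e t≡e)
        ... | inj₂ (there t∈q) = ⊥-elim (true≢false (≡-trans (sym (∈ᵇ-true t∈T)) (noneOf-∈ (_∈ᵇ T) q-outside t∈q)))
        open LastEdge p q e e∈T e∉p T⊆p

    length-matching : Fin r → length T ≡ n
    length-matching i₀ = begin
        length T
      ≡⟨ ∑-ones T ⟨
        ∑ (λ _ → 1) T
      ≡⟨ ∑-cong (λ t → ≡-trans (countᵇ-cong (λ v → does-sym _≟ᶠ_ (lookup t i₀) v) (allFin n))
                                 (countᵇ-allFin-≡ (lookup t i₀))) T ⟨
        ∑ (λ t → countᵇ (lookup t i₀ ≡ᵇᶠ_) (allFin n)) T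
      ≡⟨ ∑-comm (λ t v → 𝟙 (lookup t i₀ ≡ᵇᶠ v)) T (allFin n) ⟩
        ∑ (λ v → countᵇ (λ t → lookup t i₀ ≡ᵇᶠ v) T) (allFin n)
      ≡⟨ ∑-cong (λ v → ≡-trans (sym (length-filter (λ t → lookup t i₀ ≟ᶠ v) T)) (T-matching i₀ v)) (allFin n) ⟩
        ∑ (λ _ → 1) (allFin n)
      ≡⟨ countᵇ-allFin-true n ⟩
        n ∎
      where open ≡-Reasoning

    countᵇ-∈ᵇ : Fin r → countᵇ (_∈ᵇ T) edges ≡ length T
    countᵇ-∈ᵇ i₀ = begin
        countᵇ (_∈ᵇ T) edges
      ≡⟨ ∑-cong multiplicity edges ⟩
        ∑ (λ y → countᵇ (_≡ᵇ y) T) edges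
      ≡⟨ ∑-comm (λ y t → 𝟙 (t ≡ᵇ y)) edges T ⟩
        ∑ (λ t → countᵇ (t ≡ᵇ_) edges) T
      ≡⟨ ∑-cong (λ t → ≡-trans (countᵇ-cong (does-sym _≟ᴱ_ t) edges) (once-edges t)) T ⟩
        ∑ (λ _ → 1) T
      ≡⟨ ∑-ones T ⟩
        length T ∎
      where
        open ≡-Reasoning
        multiplicity : ∀ y → 𝟙 (y ∈ᵇ T) ≡ countᵇ (_≡ᵇ y) T
        multiplicity y with y ∈? T
        ... | yes y∈T = sym (once-in i₀ y∈T)
        ... | no y∉T = sym (countᵇ-none (_≡ᵇ y) (All.tabulate λ {t} t∈T → dec-false (t ≟ᴱ y) λ { refl → y∉T t∈T }))

    countᵇ-others : Fin r → {x : E} → x ∈ T → countᵇ (others T x) edges ≡ n ∸ 1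
    countᵇ-others i₀ {x} x∈T = begin
        countᵇ (others T x) edges
      ≡⟨ ℕ.m+n∸m≡n 1 _ ⟨
        1 + countᵇ (others T x) edges ∸ 1
      ≡⟨ cong (λ k → k + countᵇ (others T x) edges ∸ 1) count-x ⟨
        countᵇ (λ y → y ∈ᵇ T ∧ y ≡ᵇ x) edges + countᵇ (others T x) edges ∸ 1
      ≡⟨ cong (_∸ 1) (sym (countᵇ-split (_∈ᵇ T) (_≡ᵇ x) edges)) ⟩
        countᵇ (_∈ᵇ T) edges ∸ 1
      ≡⟨ cong (_∸ 1) (≡-trans (countᵇ-∈ᵇ i₀) (length-matching i₀)) ⟩
        n ∸ 1 ∎
      where
        open ≡-Reasoning
        is-x : ∀ y → (y ∈ᵇ T ∧ y ≡ᵇ x) ≡ y ≡ᵇ x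
        is-x y with y ≟ᴱ x
        ... | yes refl = ≡-trans (𝔹.∧-identityʳ _) (∈ᵇ-true x∈T)
        ... | no _ = 𝔹.∧-zeroʳ _
        count-x : countᵇ (λ y → y ∈ᵇ T ∧ y ≡ᵇ x) edges ≡ 1
        count-x = ≡-trans (countᵇ-cong is-x edges) (once-edges x)

    others⇒¬neighbours : {x : E} → x ∈ T → (σ : Fin r → Bool) → ∀ y → others T x y ≡ true → neighbours σ x y ≡ false
    others⇒¬neighbours {x} x∈T σ y other with meetsIn σ x y in meet
    ... | false = refl
    ... | true with ∃ᵇ-elim (λ i → σ i ∧ meets i x y) meet
    ...   | i , σᵢ∧meetᵢ = ⊥-elim (true≢false (≡-trans (sym (proj₂ y∈T∧y≢x)) (cong not (dec-true (y ≟ᴱ x) y≡x))))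
      where
        y∈T∧y≢x = ∧-true⁻ other
        y≡x : y ≡ x
        y≡x = meets⇒≡ i x∈T (∈ᵇ-true⁻ (proj₁ y∈T∧y≢x)) (proj₂ (∧-true⁻ σᵢ∧meetᵢ))

    count-separated : Fin r → {x : E} → x ∈ T → (σ : Fin r → Bool) →
      ∑ (𝟙 ∘ separates x (others T x) (neighbours σ x)) (perms edges) * suc ((n ∸ 1) + (meeting (popcount σ) ∸ 1)) !
        ≡ (n ^ r) ! * ((n ∸ 1) ! * (meeting (popcount σ) ∸ 1) !)
    count-separated i₀ {x} x∈T σ = begin
        S * suc ((n ∸ 1) + (meeting (popcount σ) ∸ 1)) !
      ≡⟨ cong₂ (λ b c → S * suc (b + c) !) length-Ls length-Rs ⟨
        S * suc (length Ls + length Rs) !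
      ≡⟨ count-separates x L R edges Y Ls Rs EL↭ (All.map Y-ok (filterᵇ-All _ edges))
                         (All.map Ls-ok (filterᵇ-All L edges)) (All.map Rs-ok (filterᵇ-All R edges)) ⟩
        length edges ! * (length Ls ! * length Rs !)
      ≡⟨ cong₂ (λ a b → a ! * b) length-edges (cong₂ (λ b c → b ! * c !) length-Ls length-Rs) ⟩
        (n ^ r) ! * ((n ∸ 1) ! * (meeting (popcount σ) ∸ 1) !) ∎
      where
        open ≡-Reasoning
        L = others T x
        R = neighbours σ x
        S = ∑ (𝟙 ∘ separates x L R) (perms edges)
        x⇒¬L : ∀ y → y ≡ᵇ x ≡ true → L y ≡ false
        x⇒¬L y y≡ᵇx rewrite y≡ᵇx = 𝔹.∧-zeroʳ _
        x⇒¬R : ∀ y → y ≡ᵇ x ≡ true → R y ≡ false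
        x⇒¬R y y≡ᵇx rewrite y≡ᵇx = 𝔹.∧-zeroʳ _
        L⇒¬R : ∀ y → L y ≡ true → R y ≡ false
        L⇒¬R = others⇒¬neighbours x∈T σ
        Y = filterᵇ (λ y → not (y ≡ᵇ x ∨ L y ∨ R y)) edges
        Ls = filterᵇ L edges
        Rs = filterᵇ R edges
        EL↭ : edges ↭ Y ++ x ∷ Ls ++ Rs
        EL↭ = subst (λ X → edges ↭ Y ++ X ++ Ls ++ Rs)
                    (≡-trans (filterᵇ-≡ᵇ x edges) (cong (λ k → replicate k x) (once-edges x)))
                    (partition₄-↭ (_≡ᵇ x) L R x⇒¬L x⇒¬R L⇒¬R edges)
        Y-ok : ∀ {y} → not (y ≡ᵇ x ∨ L y ∨ R y) ≡ true → Only x L R false false y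
        Y-ok {y} none with y ≡ᵇ x in y≡ᵇx | L y in Ly | R y in Ry
        ... | false | false | false = ≡ᵇ-false⇒≢ y≡ᵇx , refl , refl
        Ls-ok : ∀ {y} → L y ≡ true → Only x L R true false y
        Ls-ok {y} Ly = ≡ᵇ-false⇒≢ (𝔹.not-injective (proj₂ (∧-true⁻ Ly))) , Ly , L⇒¬R y Ly
        Rs-ok : ∀ {y} → R y ≡ true → Only x L R false true y
        Rs-ok {y} Ry with L y in Ly
        ... | true = ⊥-elim (true≢false (≡-trans (sym Ry) (L⇒¬R y Ly)))
        ... | false = ≡ᵇ-false⇒≢ (𝔹.not-injective (proj₂ (∧-true⁻ Ry))) , refl , Ry
        length-Ls : length Ls ≡ n ∸ 1
        length-Ls = ≡-trans (length-filterᵇ L edges) (countᵇ-others i₀ x∈T)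
        length-Rs : length Rs ≡ meeting (popcount σ) ∸ 1
        length-Rs = ≡-trans (length-filterᵇ R edges) (countᵇ-neighbours σ x)

module ∑ℚ = FiniteSum (CommutativeRing.commutativeSemiring ℚ.+-*-commutativeRing)
open ∑ℚ using () renaming (∑ to ∑ℚ)

ι : ℕ → ℚ
ι k = frac k 1

⟦_⟧ : Bool → ℚ
⟦ b ⟧ = ι (𝟙 b)

private
  fracᵘ : (a d : ℕ) → ℚ.toℚᵘ (frac a (suc d)) ≃ᵘ mkℚᵘ (ℤ.+ a) d
  fracᵘ a d = ℚ.toℚᵘ-fromℚᵘ (mkℚᵘ (ℤ.+ a) d)

ι-+ : (a b : ℕ) → ι (a + b) ≡ ι a ℚ.+ ι b
ι-+ a b = ℚ.toℚᵘ-injective (ℚᵘ.≃-trans (fracᵘ (a + b) 0)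
  (ℚᵘ.≃-trans (*≡* eq) (ℚᵘ.≃-sym (ℚᵘ.≃-trans (ℚ.toℚᵘ-homo-+ (ι a) (ι b)) (ℚᵘ.+-cong (fracᵘ a 0) (fracᵘ b 0))))))
  where
    eq : ℤ.+ (a + b) ℤ.* ℤ.+ 1 ≡ (ℤ.+ a ℤ.* ℤ.+ 1 ℤ.+ ℤ.+ b ℤ.* ℤ.+ 1) ℤ.* ℤ.+ 1
    eq = cong (ℤ._* ℤ.+ 1) (≡-trans (ℤ.pos-+ a b) (sym (cong₂ ℤ._+_ (ℤ.*-identityʳ (ℤ.+ a)) (ℤ.*-identityʳ (ℤ.+ b)))))

ι-* : (a b : ℕ) → ι (a * b) ≡ ι a ℚ.* ι b
ι-* a b = ℚ.toℚᵘ-injective (ℚᵘ.≃-trans (fracᵘ (a * b) 0)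
  (ℚᵘ.≃-trans (*≡* (cong (ℤ._* ℤ.+ 1) (ℤ.pos-* a b)))
    (ℚᵘ.≃-sym (ℚᵘ.≃-trans (ℚ.toℚᵘ-homo-* (ι a) (ι b)) (ℚᵘ.*-cong (fracᵘ a 0) (fracᵘ b 0))))))

frac-*-ι : (a d : ℕ) → .{{_ : NonZero d}} → frac a d ℚ.* ι d ≡ ι a
frac-*-ι a (suc d) = ℚ.toℚᵘ-injective (ℚᵘ.≃-trans (ℚ.toℚᵘ-homo-* (frac a (suc d)) (ι (suc d)))
  (ℚᵘ.≃-trans (ℚᵘ.*-cong (fracᵘ a d) (fracᵘ (suc d) 0)) (ℚᵘ.≃-trans (*≡* eq) (ℚᵘ.≃-sym (fracᵘ a 0)))))
  where
    eq : (ℤ.+ a ℤ.* ℤ.+ suc d) ℤ.* ℤ.+ 1 ≡ ℤ.+ a ℤ.* ℤ.+ (suc d * 1)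
    eq = ≡-trans (ℤ.*-identityʳ _) (cong (λ t → ℤ.+ a ℤ.* ℤ.+ t) (sym (ℕ.*-identityʳ (suc d))))

ι-∑ : {A : Set} (f : A → ℕ) (xs : List A) → ι (∑ f xs) ≡ ∑ℚ (ι ∘ f) xs
ι-∑ f [] = refl
ι-∑ f (x ∷ xs) = ≡-trans (ι-+ (f x) (∑ f xs)) (cong (ι (f x) ℚ.+_) (ι-∑ f xs))

*-cancelʳ-ι : (x y : ℚ) (d : ℕ) → .{{_ : NonZero d}} → x ℚ.* ι d ≡ y ℚ.* ι d → x ≡ y
*-cancelʳ-ι x y d eq = begin
    x                             ≡⟨ ℚ.*-identityʳ x ⟨
    x ℚ.* 1ℚ                      ≡⟨ cong (x ℚ.*_) ι*frac1 ⟨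
    x ℚ.* (ι d ℚ.* frac 1 d)      ≡⟨ ℚ.*-assoc x (ι d) (frac 1 d) ⟨
    (x ℚ.* ι d) ℚ.* frac 1 d      ≡⟨ cong (ℚ._* frac 1 d) eq ⟩
    (y ℚ.* ι d) ℚ.* frac 1 d      ≡⟨ ℚ.*-assoc y (ι d) (frac 1 d) ⟩
    y ℚ.* (ι d ℚ.* frac 1 d)      ≡⟨ cong (y ℚ.*_) ι*frac1 ⟩
    y ℚ.* 1ℚ                      ≡⟨ ℚ.*-identityʳ y ⟩
    y                             ∎
  where
    open ≡-Reasoning
    ι*frac1 : ι d ℚ.* frac 1 d ≡ 1ℚ
    ι*frac1 = ≡-trans (ℚ.*-comm (ι d) (frac 1 d)) (frac-*-ι 1 d)

frac-≡ : (a b d e : ℕ) → .{{_ : NonZero d}} → .{{_ : NonZero e}} → a * e ≡ b * d → frac a d ≡ frac b e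
frac-≡ a b d e ae≡bd = *-cancelʳ-ι (frac a d) (frac b e) d (*-cancelʳ-ι _ _ e (begin
    (frac a d ℚ.* ι d) ℚ.* ι e     ≡⟨ cong (ℚ._* ι e) (frac-*-ι a d) ⟩
    ι a ℚ.* ι e                    ≡⟨ ι-* a e ⟨
    ι (a * e)                      ≡⟨ cong ι ae≡bd ⟩
    ι (b * d)                      ≡⟨ ι-* b d ⟩
    ι b ℚ.* ι d                    ≡⟨ cong (ℚ._* ι d) (frac-*-ι b e) ⟨
    (frac b e ℚ.* ι e) ℚ.* ι d     ≡⟨ +-*-Solver.solve 3 (λ f x y → (f :* x) :* y := (f :* y) :* x) refl (frac b e) (ι e) (ι d) ⟩
    (frac b e ℚ.* ι d) ℚ.* ι e     ∎))
  where
    open ≡-Reasoning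
    open +-*-Solver using (_:*_; _:=_)

ι-*-frac : (a b d : ℕ) → .{{_ : NonZero d}} → ι a ℚ.* frac b d ≡ frac (a * b) d
ι-*-frac a b d = *-cancelʳ-ι _ _ d (begin
    (ι a ℚ.* frac b d) ℚ.* ι d    ≡⟨ ℚ.*-assoc (ι a) (frac b d) (ι d) ⟩
    ι a ℚ.* (frac b d ℚ.* ι d)    ≡⟨ cong (ι a ℚ.*_) (frac-*-ι b d) ⟩
    ι a ℚ.* ι b                   ≡⟨ ι-* a b ⟨
    ι (a * b)                     ≡⟨ frac-*-ι (a * b) d ⟨
    frac (a * b) d ℚ.* ι d        ∎)
  where open ≡-Reasoning

ι-≡-frac : (h a d : ℕ) → .{{_ : NonZero d}} → h * d ≡ a → ι h ≡ frac a d
ι-≡-frac h a d hd≡a = *-cancelʳ-ι (ι h) (frac a d) d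
  (≡-trans (sym (ι-* h d)) (≡-trans (cong ι hd≡a) (sym (frac-*-ι a d))))

frac≡ι*frac1 : (a d : ℕ) → .{{_ : NonZero d}} → frac a d ≡ ι a ℚ.* frac 1 d
frac≡ι*frac1 a d = sym (≡-trans (ι-*-frac a 1 d) (cong (λ b → frac b d) (ℕ.*-identityʳ a)))

∑ℚ-const : {A : Set} (c : ℚ) (xs : List A) → ∑ℚ (λ _ → c) xs ≡ ι (length xs) ℚ.* c
∑ℚ-const c [] = sym (ℚ.*-zeroˡ c)
∑ℚ-const c (x ∷ xs) = begin
    c ℚ.+ ∑ℚ (λ _ → c) xs             ≡⟨ cong (c ℚ.+_) (∑ℚ-const c xs) ⟩
    c ℚ.+ ι (length xs) ℚ.* c         ≡⟨ cong (ℚ._+ ι (length xs) ℚ.* c) (ℚ.*-identityˡ c) ⟨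
    1ℚ ℚ.* c ℚ.+ ι (length xs) ℚ.* c  ≡⟨ ℚ.*-distribʳ-+ c 1ℚ (ι (length xs)) ⟨
    (1ℚ ℚ.+ ι (length xs)) ℚ.* c      ≡⟨ cong (ℚ._* c) (ι-+ 1 (length xs)) ⟨
    ι (suc (length xs)) ℚ.* c         ∎
  where open ≡-Reasoning

sumℚ-map : {A : Set} (f : A → ℚ) (xs : List A) → sumℚ (map f xs) ≡ ∑ℚ f xs
sumℚ-map f [] = refl
sumℚ-map f (x ∷ xs) = cong (f x ℚ.+_) (sumℚ-map f xs)

sumℕ-map : {A : Set} (f : A → ℕ) (xs : List A) → sumℕ (map f xs) ≡ ∑ f xs
sumℕ-map f [] = refl
sumℕ-map f (x ∷ xs) = cong (f x +_) (sumℕ-map f xs)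

∑ℚ-neg : {A : Set} (f : A → ℚ) (xs : List A) → ∑ℚ (λ x → ℚ.- f x) xs ≡ ℚ.- ∑ℚ f xs
∑ℚ-neg f [] = refl
∑ℚ-neg f (x ∷ xs) = ≡-trans (cong (ℚ.- f x ℚ.+_) (∑ℚ-neg f xs)) (sym (ℚ.neg-distrib-+ (f x) _))

subsetsᶠ : (m : ℕ) → List (Fin m → Bool)
subsetsᶠ zero = (λ ()) ∷ []
subsetsᶠ (suc m) = map (false ∷ᶠ_) (subsetsᶠ m) ++ map (true ∷ᶠ_) (subsetsᶠ m)

inclusion-exclusion : (m : ℕ) (u : Fin m → Bool) →
  ∑ℚ (λ σ → sign (popcount σ) ℚ.* ⟦ ∀ᵇ (λ i → not (σ i) ∨ u i) ⟧) (subsetsᶠ m) ≡ ⟦ ∀ᵇ (not ∘ u) ⟧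
inclusion-exclusion zero u = ≡-trans (ℚ.+-identityʳ _) (ℚ.*-identityˡ _)
inclusion-exclusion (suc m) u = begin
    ∑ℚ F (map (false ∷ᶠ_) S ++ map (true ∷ᶠ_) S)
  ≡⟨ ∑ℚ.∑-++ F (map (false ∷ᶠ_) S) (map (true ∷ᶠ_) S) ⟩
    ∑ℚ F (map (false ∷ᶠ_) S) ℚ.+ ∑ℚ F (map (true ∷ᶠ_) S)
  ≡⟨ cong₂ ℚ._+_ (≡-trans (∑ℚ.∑-map F (false ∷ᶠ_) S) (inclusion-exclusion m (u ∘ Fin.suc)))
                 (∑ℚ.∑-map F (true ∷ᶠ_) S) ⟩
    ⟦ ∀ᵇ (not ∘ u ∘ Fin.suc) ⟧ ℚ.+ ∑ℚ (λ σ → ℚ.- sign (popcount σ) ℚ.* ⟦ u Fin.zero ∧ R σ ⟧) S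
  ≡⟨ by-u₀ (u Fin.zero) refl ⟩
    ⟦ ∀ᵇ (not ∘ u) ⟧ ∎
  where
    open ≡-Reasoning
    S = subsetsᶠ m
    F : (Fin (suc m) → Bool) → ℚ
    F σ = sign (popcount σ) ℚ.* ⟦ ∀ᵇ (λ i → not (σ i) ∨ u i) ⟧
    R : (Fin m → Bool) → Bool
    R σ = ∀ᵇ (λ i → not (σ i) ∨ u (Fin.suc i))
    by-u₀ : (b : Bool) → u Fin.zero ≡ b →
      ⟦ ∀ᵇ (not ∘ u ∘ Fin.suc) ⟧ ℚ.+ ∑ℚ (λ σ → ℚ.- sign (popcount σ) ℚ.* ⟦ u Fin.zero ∧ R σ ⟧) S ≡ ⟦ ∀ᵇ (not ∘ u) ⟧
    by-u₀ true u₀ rewrite u₀ = begin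
        ⟦ ∀ᵇ (not ∘ u ∘ Fin.suc) ⟧ ℚ.+ ∑ℚ (λ σ → ℚ.- sign (popcount σ) ℚ.* ⟦ R σ ⟧) S
      ≡⟨ cong (⟦ ∀ᵇ (not ∘ u ∘ Fin.suc) ⟧ ℚ.+_)
              (≡-trans (∑ℚ.∑-cong (λ σ → sym (ℚ.neg-distribˡ-* (sign (popcount σ)) ⟦ R σ ⟧)) S)
                       (≡-trans (∑ℚ-neg _ S) (cong ℚ.-_ (inclusion-exclusion m (u ∘ Fin.suc))))) ⟩
        ⟦ ∀ᵇ (not ∘ u ∘ Fin.suc) ⟧ ℚ.+ ℚ.- ⟦ ∀ᵇ (not ∘ u ∘ Fin.suc) ⟧
      ≡⟨ ℚ.+-inverseʳ ⟦ ∀ᵇ (not ∘ u ∘ Fin.suc) ⟧ ⟩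
        0ℚ ∎
    by-u₀ false u₀ rewrite u₀ = ≡-trans
      (cong (⟦ ∀ᵇ (not ∘ u ∘ Fin.suc) ⟧ ℚ.+_) (≡-trans (∑ℚ.∑-cong (λ σ → ℚ.*-zeroʳ (ℚ.- sign (popcount σ))) S) (∑ℚ.∑-zero S)))
      (ℚ.+-identityʳ ⟦ ∀ᵇ (not ∘ u ∘ Fin.suc) ⟧)



∑ℚ-shift : (m : ℕ) (φ : ℕ → ℚ) → φ (suc m) ≡ 0ℚ →
           ∑ℚ (φ ∘ suc) (upTo m) ≡ φ 1 ℚ.+ ∑ℚ (φ ∘ suc ∘ suc) (upTo m)
∑ℚ-shift zero φ φ₁≡0 = ≡-trans (sym φ₁≡0) (sym (ℚ.+-identityʳ (φ 1)))
∑ℚ-shift (suc m) φ φₘ≡0 = ≡-trans (∑ℚ.∑-upTo-suc (φ ∘ suc) m)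
  (cong (φ 1 ℚ.+_) (≡-trans (∑ℚ-shift m (φ ∘ suc) φₘ≡0) (sym (∑ℚ.∑-upTo-suc (φ ∘ suc ∘ suc) m))))

∑-popcount : (m : ℕ) (g : ℕ → ℚ) →
  ∑ℚ (g ∘ popcount) (subsetsᶠ m) ≡ g 0 ℚ.+ ∑ℚ (λ j → ι (m C suc j) ℚ.* g (suc j)) (upTo m)
∑-popcount zero g = refl
∑-popcount (suc m) g = begin
    ∑ℚ (g ∘ popcount) (map (false ∷ᶠ_) S ++ map (true ∷ᶠ_) S)
  ≡⟨ ∑ℚ.∑-++ (g ∘ popcount) (map (false ∷ᶠ_) S) (map (true ∷ᶠ_) S) ⟩
    ∑ℚ (g ∘ popcount) (map (false ∷ᶠ_) S) ℚ.+ ∑ℚ (g ∘ popcount) (map (true ∷ᶠ_) S)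
  ≡⟨ cong₂ ℚ._+_ (≡-trans (∑ℚ.∑-map (g ∘ popcount) (false ∷ᶠ_) S) (∑-popcount m g))
                 (≡-trans (∑ℚ.∑-map (g ∘ popcount) (true ∷ᶠ_) S) (∑-popcount m (g ∘ suc))) ⟩
    (g 0 ℚ.+ ∑ℚ (φ ∘ suc) (upTo m)) ℚ.+ (g 1 ℚ.+ B)
  ≡⟨ cong (λ t → (g 0 ℚ.+ t) ℚ.+ (g 1 ℚ.+ B)) (∑ℚ-shift m φ φₘ₊₁≡0) ⟩
    (g 0 ℚ.+ (c₁ ℚ.* g 1 ℚ.+ A)) ℚ.+ (g 1 ℚ.+ B)
  ≡⟨ +-*-Solver.solve 5 (λ g₀ g₁ c a b → (g₀ :+ (c :* g₁ :+ a)) :+ (g₁ :+ b) := g₀ :+ ((con 1ℚ :+ c) :* g₁ :+ (b :+ a)))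
                        refl (g 0) (g 1) c₁ A B ⟩
    g 0 ℚ.+ ((1ℚ ℚ.+ c₁) ℚ.* g 1 ℚ.+ (B ℚ.+ A))
  ≡⟨ cong₂ (λ c s → g 0 ℚ.+ (c ℚ.* g 1 ℚ.+ s))
           (≡-trans (sym (ι-+ 1 (m C 1))) (cong ι (nCk+nC[k+1]≡[n+1]C[k+1] m 0))) pascal ⟩
    g 0 ℚ.+ (ι (suc m C 1) ℚ.* g 1 ℚ.+ ∑ℚ (λ j → ι (suc m C suc (suc j)) ℚ.* g (suc (suc j))) (upTo m))
  ≡⟨ cong (g 0 ℚ.+_) (∑ℚ.∑-upTo-suc (λ j → ι (suc m C suc j) ℚ.* g (suc j)) m) ⟨
    g 0 ℚ.+ ∑ℚ (λ j → ι (suc m C suc j) ℚ.* g (suc j)) (upTo (suc m)) ∎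
  where
    open ≡-Reasoning
    open +-*-Solver using (_:+_; _:*_; _:=_; con)
    S = subsetsᶠ m
    φ : ℕ → ℚ
    φ k = ι (m C k) ℚ.* g k
    φₘ₊₁≡0 : φ (suc m) ≡ 0ℚ
    φₘ₊₁≡0 = ≡-trans (cong (λ c → ι c ℚ.* g (suc m)) (k>n⇒nCk≡0 (ℕ.n<1+n m))) (ℚ.*-zeroˡ (g (suc m)))
    c₁ = ι (m C 1)
    A = ∑ℚ (φ ∘ suc ∘ suc) (upTo m)
    B = ∑ℚ (λ j → ι (m C suc j) ℚ.* g (suc (suc j))) (upTo m)
    pascal : B ℚ.+ A ≡ ∑ℚ (λ j → ι (suc m C suc (suc j)) ℚ.* g (suc (suc j))) (upTo m)
    pascal = ≡-trans (sym (∑ℚ.∑-+ _ _ (upTo m))) (∑ℚ.∑-cong (λ j → begin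
        ι (m C suc j) ℚ.* g (suc (suc j)) ℚ.+ ι (m C suc (suc j)) ℚ.* g (suc (suc j))
      ≡⟨ ℚ.*-distribʳ-+ (g (suc (suc j))) (ι (m C suc j)) (ι (m C suc (suc j))) ⟨
        (ι (m C suc j) ℚ.+ ι (m C suc (suc j))) ℚ.* g (suc (suc j))
      ≡⟨ cong (ℚ._* g (suc (suc j))) (≡-trans (sym (ι-+ (m C suc j) (m C suc (suc j)))) (cong ι (nCk+nC[k+1]≡[n+1]C[k+1] m (suc j)))) ⟩
        ι (suc m C suc (suc j)) ℚ.* g (suc (suc j)) ∎) (upTo m))

∑-signed-popcount : (m : ℕ) (P : ℕ → ℚ) →
  P 0 ℚ.- ∑ℚ (λ σ → sign (popcount σ) ℚ.* P (popcount σ)) (subsetsᶠ m)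
    ≡ ∑ℚ (λ j → sign j ℚ.* (ι (m C suc j) ℚ.* P (suc j))) (upTo m)
∑-signed-popcount m P = begin
    P 0 ℚ.- ∑ℚ (λ σ → sign (popcount σ) ℚ.* P (popcount σ)) (subsetsᶠ m)
  ≡⟨ cong (λ t → P 0 ℚ.- t) (∑-popcount m (λ k → sign k ℚ.* P k)) ⟩
    P 0 ℚ.- (1ℚ ℚ.* P 0 ℚ.+ X)
  ≡⟨ +-*-Solver.solve 2 (λ p x → p :- (con 1ℚ :* p :+ x) := :- x) refl (P 0) X ⟩
    ℚ.- X
  ≡⟨ ∑ℚ-neg (λ j → ι (m C suc j) ℚ.* (ℚ.- sign j ℚ.* P (suc j))) (upTo m) ⟨
    ∑ℚ (λ j → ℚ.- (ι (m C suc j) ℚ.* (ℚ.- sign j ℚ.* P (suc j)))) (upTo m)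
  ≡⟨ ∑ℚ.∑-cong (λ j → +-*-Solver.solve 3 (λ c s p → :- (c :* (:- s :* p)) := s :* (c :* p)) refl
                        (ι (m C suc j)) (sign j) (P (suc j))) (upTo m) ⟩
    ∑ℚ (λ j → sign j ℚ.* (ι (m C suc j) ℚ.* P (suc j))) (upTo m) ∎
  where
    open ≡-Reasoning
    open +-*-Solver using (_:+_; _:*_; _:-_; :-_; _:=_; con)
    X = ∑ℚ (λ j → ι (m C suc j) ℚ.* (ℚ.- sign j ℚ.* P (suc j))) (upTo m)

⟦⟧-∧ : (a b : Bool) → ⟦ a ∧ b ⟧ ≡ ⟦ a ⟧ ℚ.* ⟦ b ⟧
⟦⟧-∧ true b = sym (ℚ.*-identityˡ ⟦ b ⟧)
⟦⟧-∧ false b = sym (ℚ.*-zeroˡ ⟦ b ⟧)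

⟦⟧-∧-not : (a b : Bool) → ⟦ a ∧ b ⟧ ≡ ⟦ a ⟧ ℚ.- ⟦ a ∧ not b ⟧
⟦⟧-∧-not true true = refl
⟦⟧-∧-not true false = refl
⟦⟧-∧-not false b = refl

-- The probability that, in a uniformly random ordering of b + c + 1 items, a given item comes after
-- b given others and before the remaining c.
separation-probability : ℕ → ℕ → ℚ
separation-probability b c = frac (b ! * c !) (suc (b + c) !)

C*!*!≡! : (m k : ℕ) → k ≤ m → (m C k) * (k ! * (m ∸ k) !) ≡ m !
C*!*!≡! m k k≤m = ≡-trans (cong (_* (k ! * (m ∸ k) !)) (nCk≡n!/k![n-k]! k≤m))
                          (m/n*n≡m {{ℕ._!*_!≢0 k (m ∸ k)}} (k![n∸k]!∣n! k≤m))

C≢0 : (m k : ℕ) → k ≤ m → NonZero (m C k)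
C≢0 m k k≤m with m C k | C*!*!≡! m k k≤m
... | zero | 0≡m! = ⊥-elim (ℕ.<⇒≢ (ℕ.1≤n! m) 0≡m!)
... | suc _ | _ = _

ι-*-separation-probability : (b c : ℕ) →
  ι (suc b) ℚ.* separation-probability b c ≡ frac 1 ((suc c + b) C suc b)
ι-*-separation-probability b c = ≡-trans (ι-*-frac (suc b) (b ! * c !) (suc (b + c) !) {{ℕ._!≢0 (suc (b + c))}})
  (frac-≡ _ 1 _ _ {{ℕ._!≢0 (suc (b + c))}} {{C≢0 (suc c + b) (suc b) b<m}} (begin
    (suc b * (b ! * c !)) * (m C suc b)       ≡⟨ ℕ-Solver.+-*-Solver.solve 4 (λ s x y z → (s :* (x :* y)) :* z := z :* ((s :* x) :* y))
                                                   refl (suc b) (b !) (c !) (m C suc b) ⟩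
    (m C suc b) * (suc b ! * c !)              ≡⟨ cong (λ d → (m C suc b) * (suc b ! * d !)) (ℕ.m+n∸n≡m c b) ⟨
    (m C suc b) * (suc b ! * (m ∸ suc b) !)    ≡⟨ C*!*!≡! m (suc b) b<m ⟩
    m !                                        ≡⟨ cong (λ d → suc d !) (ℕ.+-comm c b) ⟩
    suc (b + c) !                              ≡⟨ ℕ.*-identityˡ _ ⟨
    1 * suc (b + c) !                          ∎))
  where
    open ≡-Reasoning
    open ℕ-Solver.+-*-Solver using (_:*_; _:=_)
    m = suc c + b
    b<m : suc b ≤ m
    b<m = s≤s (ℕ.m≤n+m b c)

module Expectation (r n : ℕ) where

  open Hypergraph r n

  sep-prob : ℕ → ℚ
  sep-prob k = separation-probability (n ∸ 1) (meeting k ∸ 1)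

  alt-sum : ℚ
  alt-sum = ∑ℚ (λ j → sign j ℚ.* (ι (r C suc j) ℚ.* sep-prob (suc j))) (upTo r)

  module _ {T : List E} (T-matching : IsMatching T) (i₀ : Fin r) where

    open Matching {T} T-matching

    module _ {x : E} (x∈T : x ∈ T) where

      separated : (Fin r → Bool) → List E → Bool
      separated σ = separates x (others T x) (neighbours σ x)

      ι-count-separated : (σ : Fin r → Bool) → ι (countᵇ (separated σ) (perms edges)) ≡ ι ((n ^ r) !) ℚ.* sep-prob (popcount σ)
      ι-count-separated σ = ≡-trans (ι-≡-frac (countᵇ (separated σ) (perms edges)) ((n ^ r) ! * b!c!) d
                                              {{ℕ._!≢0 (suc (b + c))}} (count-separated i₀ x∈T σ))
                                    (sym (ι-*-frac ((n ^ r) !) b!c! d {{ℕ._!≢0 (suc (b + c))}}))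
        where
          b = n ∸ 1
          c = meeting (popcount σ) ∸ 1
          b!c! = b ! * c !
          d = suc (b + c) !

      -- Inclusion–exclusion over the parts i in which no edge before x meets x; requiring this for all
      -- i ∈ σ says that every edge of `neighbours σ x` comes after x.
      ⟦last∧fresh⟧ : (ω : List E) → x ∈ ω →
        ⟦ noneAfter x (others T x) ω ∧ fresh ω x ⟧
          ≡ ⟦ separated (λ _ → false) ω ⟧ ℚ.- ∑ℚ (λ σ → sign (popcount σ) ℚ.* ⟦ separated σ ω ⟧) (subsetsᶠ r)
      ⟦last∧fresh⟧ ω x∈ω = begin
          ⟦ a ∧ ∃ᵇ u ⟧
        ≡⟨ ⟦⟧-∧-not a (∃ᵇ u) ⟩
          ⟦ a ⟧ ℚ.- ⟦ a ∧ not (∃ᵇ u) ⟧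
        ≡⟨ cong₂ ℚ._-_ (cong ⟦_⟧ a≡separated∅) (≡-trans (cong (λ b → ⟦ a ∧ b ⟧) (not-∃ᵇ u)) (⟦⟧-∧ a (∀ᵇ (not ∘ u)))) ⟩
          ⟦ separated (λ _ → false) ω ⟧ ℚ.- ⟦ a ⟧ ℚ.* ⟦ ∀ᵇ (not ∘ u) ⟧
        ≡⟨ cong (λ t → ⟦ separated (λ _ → false) ω ⟧ ℚ.- ⟦ a ⟧ ℚ.* t) (inclusion-exclusion r u) ⟨
          ⟦ separated (λ _ → false) ω ⟧ ℚ.- ⟦ a ⟧ ℚ.* ∑ℚ (λ σ → sign (popcount σ) ℚ.* ⟦ ∀ᵇ (λ i → not (σ i) ∨ u i) ⟧) (subsetsᶠ r)
        ≡⟨ cong (λ t → ⟦ separated (λ _ → false) ω ⟧ ℚ.- t) (≡-trans (sym (∑ℚ.∑-*ˡ ⟦ a ⟧ _ (subsetsᶠ r))) (∑ℚ.∑-cong per-σ (subsetsᶠ r))) ⟩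
          ⟦ separated (λ _ → false) ω ⟧ ℚ.- ∑ℚ (λ σ → sign (popcount σ) ℚ.* ⟦ separated σ ω ⟧) (subsetsᶠ r) ∎
        where
          open ≡-Reasoning
          a = noneAfter x (others T x) ω
          u : Fin r → Bool
          u i = noneBefore x (meets i x) ω
          a≡separated∅ : a ≡ separated (λ _ → false) ω
          a≡separated∅ = sym (≡-trans (cong (a ∧_) (≡-trans (noneBefore-neighbours (λ _ → false) x ω x∈ω) (∀ᵇ-intro {r} _ (λ _ → refl))))
                                      (𝔹.∧-identityʳ a))
          per-σ : ∀ σ → ⟦ a ⟧ ℚ.* (sign (popcount σ) ℚ.* ⟦ ∀ᵇ (λ i → not (σ i) ∨ u i) ⟧) ≡ sign (popcount σ) ℚ.* ⟦ separated σ ω ⟧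
          per-σ σ = begin
              ⟦ a ⟧ ℚ.* (sign (popcount σ) ℚ.* ⟦ ∀ᵇ (λ i → not (σ i) ∨ u i) ⟧)
            ≡⟨ +-*-Solver.solve 3 (λ p s q → p :* (s :* q) := s :* (p :* q)) refl ⟦ a ⟧ (sign (popcount σ)) ⟦ ∀ᵇ (λ i → not (σ i) ∨ u i) ⟧ ⟩
              sign (popcount σ) ℚ.* (⟦ a ⟧ ℚ.* ⟦ ∀ᵇ (λ i → not (σ i) ∨ u i) ⟧)
            ≡⟨ cong (sign (popcount σ) ℚ.*_) (≡-trans (sym (⟦⟧-∧ a _)) (cong (λ b → ⟦ a ∧ b ⟧) (sym (noneBefore-neighbours σ x ω x∈ω)))) ⟩
              sign (popcount σ) ℚ.* ⟦ separated σ ω ⟧ ∎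
            where open +-*-Solver using (_:*_; _:=_)

      ι-count-last-fresh : ι (countᵇ (λ ω → noneAfter x (others T x) ω ∧ fresh ω x) (perms edges)) ≡ ι ((n ^ r) !) ℚ.* alt-sum
      ι-count-last-fresh = begin
          ι (countᵇ last-fresh (perms edges))
        ≡⟨ ι-∑ (𝟙 ∘ last-fresh) (perms edges) ⟩
          ∑ℚ (⟦_⟧ ∘ last-fresh) (perms edges)
        ≡⟨ ∑ℚ.∑-cong-All (All.map (λ ω↭edges → ⟦last∧fresh⟧ _ (∈-↭ ω↭edges x)) (perms-↭ edges)) ⟩
          ∑ℚ (λ ω → ⟦ separated ∅ ω ⟧ ℚ.- signed ω) (perms edges)
        ≡⟨ ∑ℚ.∑-+ (⟦_⟧ ∘ separated ∅) (λ ω → ℚ.- signed ω) (perms edges) ⟩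
          ∑ℚ (⟦_⟧ ∘ separated ∅) (perms edges) ℚ.+ ∑ℚ (λ ω → ℚ.- signed ω) (perms edges)
        ≡⟨ cong₂ ℚ._+_ (sym (ι-∑ (𝟙 ∘ separated ∅) (perms edges))) (∑ℚ-neg signed (perms edges)) ⟩
          ι (countᵇ (separated ∅) (perms edges)) ℚ.- ∑ℚ signed (perms edges)
        ≡⟨ cong (λ t → ι (countᵇ (separated ∅) (perms edges)) ℚ.- t) signed-by-σ ⟩
          ι (countᵇ (separated ∅) (perms edges)) ℚ.- ∑ℚ (λ σ → sign (popcount σ) ℚ.* ι (countᵇ (separated σ) (perms edges))) (subsetsᶠ r)
        ≡⟨ cong₂ ℚ._-_ (≡-trans (ι-count-separated ∅) (cong (λ k → ι ((n ^ r) !) ℚ.* sep-prob k) (popcount-∅ {r})))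
                       (∑ℚ.∑-cong (λ σ → cong (sign (popcount σ) ℚ.*_) (ι-count-separated σ)) (subsetsᶠ r)) ⟩
          ι ((n ^ r) !) ℚ.* sep-prob 0 ℚ.- ∑ℚ (λ σ → sign (popcount σ) ℚ.* (ι ((n ^ r) !) ℚ.* sep-prob (popcount σ))) (subsetsᶠ r)
        ≡⟨ cong (λ t → ι ((n ^ r) !) ℚ.* sep-prob 0 ℚ.- t)
                (≡-trans (∑ℚ.∑-cong (λ σ → +-*-Solver.solve 3 (λ s c p → s :* (c :* p) := c :* (s :* p)) refl
                                              (sign (popcount σ)) (ι ((n ^ r) !)) (sep-prob (popcount σ))) (subsetsᶠ r))
                         (∑ℚ.∑-*ˡ (ι ((n ^ r) !)) (λ σ → sign (popcount σ) ℚ.* sep-prob (popcount σ)) (subsetsᶠ r))) ⟩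
          ι ((n ^ r) !) ℚ.* sep-prob 0 ℚ.- ι ((n ^ r) !) ℚ.* ∑ℚ (λ σ → sign (popcount σ) ℚ.* sep-prob (popcount σ)) (subsetsᶠ r)
        ≡⟨ +-*-Solver.solve 3 (λ c p q → c :* p :- c :* q := c :* (p :- q)) refl
             (ι ((n ^ r) !)) (sep-prob 0) (∑ℚ (λ σ → sign (popcount σ) ℚ.* sep-prob (popcount σ)) (subsetsᶠ r)) ⟩
          ι ((n ^ r) !) ℚ.* (sep-prob 0 ℚ.- ∑ℚ (λ σ → sign (popcount σ) ℚ.* sep-prob (popcount σ)) (subsetsᶠ r))
        ≡⟨ cong (ι ((n ^ r) !) ℚ.*_) (∑-signed-popcount r sep-prob) ⟩
          ι ((n ^ r) !) ℚ.* alt-sum ∎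
        where
          open ≡-Reasoning
          open +-*-Solver using (_:*_; _:-_; _:=_)
          ∅ : Fin r → Bool
          ∅ _ = false
          last-fresh : List E → Bool
          last-fresh ω = noneAfter x (others T x) ω ∧ fresh ω x
          signed : List E → ℚ
          signed ω = ∑ℚ (λ σ → sign (popcount σ) ℚ.* ⟦ separated σ ω ⟧) (subsetsᶠ r)
          signed-by-σ : ∑ℚ signed (perms edges) ≡ ∑ℚ (λ σ → sign (popcount σ) ℚ.* ι (countᵇ (separated σ) (perms edges))) (subsetsᶠ r)
          signed-by-σ = ≡-trans (∑ℚ.∑-comm (λ ω σ → sign (popcount σ) ℚ.* ⟦ separated σ ω ⟧) (perms edges) (subsetsᶠ r))
            (∑ℚ.∑-cong (λ σ → ≡-trans (∑ℚ.∑-*ˡ (sign (popcount σ)) (⟦_⟧ ∘ separated σ) (perms edges))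
                                      (cong (sign (popcount σ) ℚ.*_) (sym (ι-∑ (𝟙 ∘ separated σ) (perms edges)))))
                       (subsetsᶠ r))

    ι-count-⊆-stopped : Fin n → ι (countᵇ (λ ω → does (T ⊆? stoppedHypergraph ω)) (perms edges)) ≡ ι n ℚ.* (ι ((n ^ r) !) ℚ.* alt-sum)
    ι-count-⊆-stopped v₀ = begin
        ι (countᵇ (λ ω → does (T ⊆? stoppedHypergraph ω)) (perms edges))
      ≡⟨ cong ι (∑-cong-All (All.map (λ ω↭edges → 𝟙-⊆-stopped i₀ v₀ _ (once-↭ ω↭edges) (∈-↭ ω↭edges)) (perms-↭ edges))) ⟩
        ι (∑ (λ ω → ∑ (λ x → 𝟙 (last-fresh x ω)) T) (perms edges))
      ≡⟨ cong ι (∑-comm (λ ω x → 𝟙 (last-fresh x ω)) (perms edges) T) ⟩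
        ι (∑ (λ x → countᵇ (last-fresh x) (perms edges)) T)
      ≡⟨ ι-∑ (λ x → countᵇ (last-fresh x) (perms edges)) T ⟩
        ∑ℚ (λ x → ι (countᵇ (last-fresh x) (perms edges))) T
      ≡⟨ ∑ℚ.∑-cong-All (All.tabulate ι-count-last-fresh) ⟩
        ∑ℚ (λ _ → ι ((n ^ r) !) ℚ.* alt-sum) T
      ≡⟨ ∑ℚ-const (ι ((n ^ r) !) ℚ.* alt-sum) T ⟩
        ι (length T) ℚ.* (ι ((n ^ r) !) ℚ.* alt-sum)
      ≡⟨ cong (λ k → ι k ℚ.* (ι ((n ^ r) !) ℚ.* alt-sum)) (length-matching i₀) ⟩
        ι n ℚ.* (ι ((n ^ r) !) ℚ.* alt-sum) ∎
      where
        open ≡-Reasoning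
        last-fresh : E → List E → Bool
        last-fresh x ω = noneAfter x (others T x) ω ∧ fresh ω x

  ι-total : Fin r → Fin n →
    ι (∑ (numMatchings ∘ stoppedHypergraph) (perms edges))
      ≡ ι (length (filter isMatching? (subsets edges))) ℚ.* (ι n ℚ.* (ι ((n ^ r) !) ℚ.* alt-sum))
  ι-total i₀ v₀ = begin
      ι (∑ (numMatchings ∘ stoppedHypergraph) (perms edges))
    ≡⟨ cong ι (∑-cong-All (All.map (numMatchings-stopped _) (perms-↭ edges))) ⟩
      ι (∑ (λ ω → ∑ (λ H → F H ω) (subsets edges)) (perms edges))
    ≡⟨ cong ι (∑-comm (λ ω H → F H ω) (perms edges) (subsets edges)) ⟩
      ι (∑ (λ H → ∑ (F H) (perms edges)) (subsets edges))
    ≡⟨ ι-∑ (λ H → ∑ (F H) (perms edges)) (subsets edges) ⟩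
      ∑ℚ (λ H → ι (∑ (F H) (perms edges))) (subsets edges)
    ≡⟨ ∑ℚ.∑-cong (λ H → per-H H (isMatching? H)) (subsets edges) ⟩
      ∑ℚ (λ H → K ℚ.* ⟦ does (isMatching? H) ⟧) (subsets edges)
    ≡⟨ ∑ℚ.∑-*ˡ K (⟦_⟧ ∘ does ∘ isMatching?) (subsets edges) ⟩
      K ℚ.* ∑ℚ (⟦_⟧ ∘ does ∘ isMatching?) (subsets edges)
    ≡⟨ cong (K ℚ.*_) (≡-trans (sym (ι-∑ (𝟙 ∘ does ∘ isMatching?) (subsets edges)))
                              (cong ι (sym (length-filter isMatching? (subsets edges))))) ⟩
      K ℚ.* ι (length (filter isMatching? (subsets edges)))
    ≡⟨ ℚ.*-comm K _ ⟩
      ι (length (filter isMatching? (subsets edges))) ℚ.* K ∎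
    where
      open ≡-Reasoning
      K = ι n ℚ.* (ι ((n ^ r) !) ℚ.* alt-sum)
      F : List E → List E → ℕ
      F H ω = 𝟙 (does (isMatching? H) ∧ does (H ⊆? stoppedHypergraph ω))
      per-H : ∀ H → (d : Dec (IsMatching H)) → ι (∑ (λ ω → 𝟙 (does d ∧ does (H ⊆? stoppedHypergraph ω))) (perms edges)) ≡ K ℚ.* ⟦ does d ⟧
      per-H H (yes H-matching) = ≡-trans (ι-count-⊆-stopped {H} H-matching i₀ v₀) (sym (ℚ.*-identityʳ K))
      per-H H (no _) = ≡-trans (cong ι (∑-zero (perms edges))) (sym (ℚ.*-zeroʳ K))

*-^-distrib : (a b o : ℕ) → a ^ o * b ^ o ≡ (a * b) ^ o
*-^-distrib a b zero = refl
*-^-distrib a b (suc o) = ≡-trans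
  (ℕ-Solver.+-*-Solver.solve 4 (λ a b x y → (a :* x) :* (b :* y) := (a :* b) :* (x :* y)) refl a b (a ^ o) (b ^ o))
  (cong ((a * b) *_) (*-^-distrib a b o))
  where open ℕ-Solver.+-*-Solver using (_:*_; _:=_)

module PerfectMatchings (r′ n : ℕ) where

  open import Data.List.Membership.DecPropositional (_≟ᶠ_ {n}) using () renaming (_∈?_ to _∈ᶠ?_)

  E : Set
  E = Vec (Fin n) (suc r′)

  tails : List (Vec (Fin n) r′)
  tails = allVecs r′ n

  edgesFrom : List (Fin n) → List E
  edgesFrom ks = concatMap (λ v → map (v ∷ᵛ_) tails) ks

  degree : Fin (suc r′) → Fin n → List E → ℕ
  degree i v S = countᵇ (λ e → lookup e i ≡ᵇᶠ v) S

  Exact : (Fin (suc r′) → Fin n → Bool) → List E → Set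
  Exact c S = ∀ i v → degree i v S ≡ 𝟙 (c i v)

  exact? : (c : Fin (suc r′) → Fin n → Bool) (S : List E) → Dec (Exact c S)
  exact? c S = Fin.all? (λ i → Fin.all? (λ v → degree i v S ℕ.≟ 𝟙 (c i v)))

  remove : (Fin (suc r′) → Fin n → Bool) → E → Fin (suc r′) → Fin n → Bool
  remove c x i v = c i v ∧ not (lookup x i ≡ᵇᶠ v)

  fits : (Fin (suc r′) → Fin n → Bool) → E → Bool
  fits c x = ∀ᵇ (λ i → c i (lookup x i))

  exact-∷ : (c : Fin (suc r′) → Fin n → Bool) (x : E) (t : List E) →
            𝟙 (does (exact? c (x ∷ t))) ≡ 𝟙 (fits c x) * 𝟙 (does (exact? (remove c x) t))
  exact-∷ c x t with fits c x in fit
  ... | true = ≡-trans (cong 𝟙 (does-⇔ (mk⇔ fwd bwd) (exact? c (x ∷ t)) (exact? (remove c x) t)))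
                       (sym (ℕ.+-identityʳ _))
    where
      cᵢxᵢ : ∀ i → c i (lookup x i) ≡ true
      cᵢxᵢ = ∀ᵇ-elim _ fit
      fwd : Exact c (x ∷ t) → Exact (remove c x) t
      fwd exact i v with lookup x i ≟ᶠ v | exact i v
      ... | yes refl | eq = ≡-trans (ℕ.suc-injective (≡-trans eq (cong 𝟙 (cᵢxᵢ i)))) (cong 𝟙 (sym (𝔹.∧-zeroʳ _)))
      ... | no _ | eq = ≡-trans eq (cong 𝟙 (sym (𝔹.∧-identityʳ (c i v))))
      bwd : Exact (remove c x) t → Exact c (x ∷ t)
      bwd exact i v with lookup x i ≟ᶠ v | exact i v
      ... | yes refl | eq = ≡-trans (cong suc (≡-trans eq (cong 𝟙 (𝔹.∧-zeroʳ _)))) (cong 𝟙 (sym (cᵢxᵢ i)))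
      ... | no _ | eq = ≡-trans eq (cong 𝟙 (𝔹.∧-identityʳ (c i v)))
  ... | false = cong 𝟙 (dec-false (exact? c (x ∷ t)) misfit)
    where
      misfit : ¬ Exact c (x ∷ t)
      misfit exact with ∀ᵇ-false⁻ _ fit
      ... | i , cᵢxᵢ = ℕ.1+n≢0 (≡-trans (cong (λ b → 𝟙 b + degree i (lookup x i) t)
                                               (sym (≡ᵇᶠ-refl (lookup x i))))
                                        (≡-trans (exact i (lookup x i)) (cong 𝟙 cᵢxᵢ)))

  head-∈ : (ks : List (Fin n)) {y : E} → y ∈ edgesFrom ks → lookup y Fin.zero ∈ ks
  head-∈ (k ∷ ks) y∈ with ∈-++⁻ (map (k ∷ᵛ_) tails) y∈
  ... | inj₂ y∈rest = there (head-∈ ks y∈rest)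
  ... | inj₁ y∈k∷ with ∈-map⁻ (k ∷ᵛ_) y∈k∷
  ...   | _ , _ , refl = here refl

  countᵇ-remove : (c : Fin (suc r′) → Fin n → Bool) (x : E) → fits c x ≡ true →
                  ∀ i → countᵇ (remove c x i) (allFin n) ≡ countᵇ (c i) (allFin n) ∸ 1
  countᵇ-remove c x fit i = begin
      countᵇ (remove c x i) (allFin n)
    ≡⟨ ℕ.m+n∸m≡n 1 _ ⟨
      1 + countᵇ (remove c x i) (allFin n) ∸ 1
    ≡⟨ cong (λ m → m + countᵇ (remove c x i) (allFin n) ∸ 1) xᵢ-once ⟨
      countᵇ (λ v → c i v ∧ lookup x i ≡ᵇᶠ v) (allFin n) + countᵇ (remove c x i) (allFin n) ∸ 1
    ≡⟨ cong (_∸ 1) (countᵇ-split (c i) (lookup x i ≡ᵇᶠ_) (allFin n)) ⟨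
      countᵇ (c i) (allFin n) ∸ 1 ∎
    where
      open ≡-Reasoning
      is-xᵢ : ∀ v → (c i v ∧ lookup x i ≡ᵇᶠ v) ≡ v ≡ᵇᶠ lookup x i
      is-xᵢ v with lookup x i ≟ᶠ v
      ... | yes refl = ≡-trans (𝔹.∧-identityʳ _) (≡-trans (∀ᵇ-elim (λ j → c j (lookup x j)) fit i) (sym (≡ᵇᶠ-refl v)))
      ... | no xᵢ≢v = ≡-trans (𝔹.∧-zeroʳ _) (sym (dec-false (v ≟ᶠ lookup x i) (xᵢ≢v ∘ sym)))
      xᵢ-once : countᵇ (λ v → c i v ∧ lookup x i ≡ᵇᶠ v) (allFin n) ≡ 1
      xᵢ-once = ≡-trans (countᵇ-cong is-xᵢ (allFin n)) (countᵇ-allFin-≡ (lookup x i))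

  remove-head : {k : Fin n} {ks : List (Fin n)} → k ∉ ks → (c : Fin (suc r′) → Fin n → Bool) →
                (∀ v → c Fin.zero v ≡ does (v ∈ᶠ? (k ∷ ks))) →
                (w : Vec (Fin n) r′) → ∀ v → remove c (k ∷ᵛ w) Fin.zero v ≡ does (v ∈ᶠ? ks)
  remove-head {k} {ks} k∉ks c c₀ w v with k ≟ᶠ v
  ... | yes refl = ≡-trans (𝔹.∧-zeroʳ _) (sym (dec-false (k ∈ᶠ? ks) k∉ks))
  ... | no k≢v = ≡-trans (𝔹.∧-identityʳ _) (≡-trans (c₀ v)
                   (does-⇔ (mk⇔ (λ { (here v≡k) → ⊥-elim (k≢v (sym v≡k)) ; (there v∈ks) → v∈ks }) there)
                           (v ∈ᶠ? (k ∷ ks)) (v ∈ᶠ? ks)))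

  head-∈-map : {k : Fin n} {x : E} → x ∈ map (k ∷ᵛ_) tails → lookup x Fin.zero ≡ᵇᶠ k ≡ true
  head-∈-map {k} x∈ with ∈-map⁻ (k ∷ᵛ_) x∈
  ... | _ , _ , refl = ≡ᵇᶠ-refl k

  degree-outside : {k : Fin n} {ks : List (Fin n)} → All (k ≢_) ks → {t : List E} → t ⊆ edgesFrom ks →
                   degree Fin.zero k t ≡ 0
  degree-outside {k} {ks} k∉ks t⊆ = countᵇ-none (λ e → lookup e Fin.zero ≡ᵇᶠ k) (All.tabulate λ y∈t →
    dec-false (_ ≟ᶠ k) (λ head≡k → All.lookup k∉ks (subst (_∈ ks) head≡k (head-∈ ks (t⊆ y∈t))) refl))

  count-fitting-tails : (c : Fin (suc r′) → Fin n → Bool) {k : Fin n} → c Fin.zero k ≡ true →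
    countᵇ (fits c ∘ (k ∷ᵛ_)) tails ≡ ∏ (λ i → countᵇ (c (Fin.suc i)) (allFin n))
  count-fitting-tails c {k} c₀k = ≡-trans
    (countᵇ-cong (λ w → cong (_∧ ∀ᵇ (λ i → c (Fin.suc i) (lookup w i))) c₀k) tails)
    (count-allVecs-∀ᵇ r′ n (c ∘ Fin.suc))

  -- c marks the vertices still to be covered; the edges through the vertices ks of the first part
  -- are chosen one at a time.
  count-exact : (ks : List (Fin n)) → Unique ks → (c : Fin (suc r′) → Fin n → Bool) →
    (∀ v → c Fin.zero v ≡ does (v ∈ᶠ? ks)) → (∀ i → countᵇ (c (Fin.suc i)) (allFin n) ≡ length ks) →
    countᵇ (does ∘ exact? c) (subsets (edgesFrom ks)) ≡ (length ks !) ^ r′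
  count-exact [] _ c c₀ cₛ =
    ≡-trans (ℕ.+-identityʳ _) (≡-trans (cong 𝟙 (dec-true (exact? c []) empty-exact)) (sym (ℕ.^-zeroˡ r′)))
    where
      empty-exact : Exact c []
      empty-exact Fin.zero v = cong 𝟙 (sym (c₀ v))
      empty-exact (Fin.suc i) v = cong 𝟙 (sym (countᵇ-zero (c (Fin.suc i)) (cₛ i) (∈-allFin v)))
  count-exact (k ∷ ks) (k∉ks ∷ ks-unique) c c₀ cₛ = begin
      ∑ G (subsets (X ++ edgesFrom ks))
    ≡⟨ ∑-subsets-++ G X (edgesFrom ks) ⟩
      ∑ g (subsets X)
    ≡⟨ ∑-subsets-singletons g X g-[] g-two ⟩
      ∑ (λ x → g [ x ]) X
    ≡⟨ ∑-map (λ x → g [ x ]) (k ∷ᵛ_) tails ⟩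
      ∑ (λ w → g [ k ∷ᵛ w ]) tails
    ≡⟨ ∑-cong g-one tails ⟩
      ∑ (λ w → K * 𝟙 (fits c (k ∷ᵛ w))) tails
    ≡⟨ ∑-*ˡ K (𝟙 ∘ fits c ∘ (k ∷ᵛ_)) tails ⟩
      K * countᵇ (fits c ∘ (k ∷ᵛ_)) tails
    ≡⟨ cong (K *_) (≡-trans (count-fitting-tails c c₀k) (≡-trans (∏-cong cₛ) (∏-const r′ (suc (length ks))))) ⟩
      K * suc (length ks) ^ r′
    ≡⟨ ≡-trans (ℕ.*-comm K _) (*-^-distrib (suc (length ks)) (length ks !) r′) ⟩
      (suc (length ks) !) ^ r′ ∎
    where
      open ≡-Reasoning
      X = map (k ∷ᵛ_) tails
      K = (length ks !) ^ r′
      G : List E → ℕ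
      G = 𝟙 ∘ does ∘ exact? c
      g : List E → ℕ
      g s = ∑ (λ t → G (s ++ t)) (subsets (edgesFrom ks))
      c₀k : c Fin.zero k ≡ true
      c₀k = ≡-trans (c₀ k) (dec-true (k ∈ᶠ? (k ∷ ks)) (here refl))
      inexact : ∀ S → degree Fin.zero k S ≢ 1 → G S ≡ 0
      inexact S deg≢1 = cong 𝟙 (dec-false (exact? c S) (λ exact → deg≢1 (≡-trans (exact Fin.zero k) (cong 𝟙 c₀k))))
      g-[] : g [] ≡ 0
      g-[] = ≡-trans (∑-cong-All (All.map {P = _⊆ edgesFrom ks}
                       (λ {t} t⊆ → inexact t (λ deg≡1 → ℕ.0≢1+n (≡-trans (sym (degree-outside k∉ks t⊆)) deg≡1)))
                       (subsets-⊆ (edgesFrom ks))))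
                     (∑-zero (subsets (edgesFrom ks)))
      g-two : ∀ {x y} t → x ∈ X → y ∈ X → g (x ∷ y ∷ t) ≡ 0
      g-two {x} {y} t x∈X y∈X = ≡-trans (∑-cong (λ t′ → inexact (x ∷ y ∷ t ++ t′) λ deg≡1 →
          ℕ.1+n≢0 (ℕ.suc-injective (≡-trans (cong₂ (λ a b → 𝟙 a + (𝟙 b + degree Fin.zero k (t ++ t′)))
                                                    (sym (head-∈-map x∈X)) (sym (head-∈-map y∈X))) deg≡1)))
          (subsets (edgesFrom ks))) (∑-zero (subsets (edgesFrom ks)))
      g-one : ∀ w → g [ k ∷ᵛ w ] ≡ K * 𝟙 (fits c (k ∷ᵛ w))
      g-one w = ≡-trans (∑-cong (exact-∷ c (k ∷ᵛ w)) (subsets (edgesFrom ks)))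
        (≡-trans (∑-*ˡ (𝟙 (fits c (k ∷ᵛ w))) (𝟙 ∘ does ∘ exact? (remove c (k ∷ᵛ w))) (subsets (edgesFrom ks)))
                 (≡-trans (by-fit (fits c (k ∷ᵛ w)) refl) (ℕ.*-comm _ K)))
        where
          by-fit : (b : Bool) → fits c (k ∷ᵛ w) ≡ b →
            𝟙 (fits c (k ∷ᵛ w)) * countᵇ (does ∘ exact? (remove c (k ∷ᵛ w))) (subsets (edgesFrom ks)) ≡ 𝟙 (fits c (k ∷ᵛ w)) * K
          by-fit false fit rewrite fit = refl
          by-fit true fit = cong (𝟙 (fits c (k ∷ᵛ w)) *_) (count-exact ks ks-unique (remove c (k ∷ᵛ w))
            (remove-head (λ k∈ks → All.lookup k∉ks k∈ks refl) c c₀ w)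
            (λ i → ≡-trans (countᵇ-remove c (k ∷ᵛ w) fit (Fin.suc i)) (cong (_∸ 1) (cₛ i))))

  count-perfect-matchings : length (filter isMatching? (subsets (allVecs (suc r′) n))) ≡ (n !) ^ r′
  count-perfect-matchings = begin
      length (filter isMatching? (subsets (edgesFrom (allFin n))))
    ≡⟨ length-filter isMatching? (subsets (edgesFrom (allFin n))) ⟩
      countᵇ (does ∘ isMatching?) (subsets (edgesFrom (allFin n)))
    ≡⟨ countᵇ-cong (λ S → does-⇔ (mk⇔ (λ m i v → ≡-trans (sym (length-filter _ S)) (m i v))
                                      (λ e i v → ≡-trans (length-filter _ S) (e i v)))
                                 (isMatching? S) (exact? (λ _ _ → true) S))
                   (subsets (edgesFrom (allFin n))) ⟩
      countᵇ (does ∘ exact? (λ _ _ → true)) (subsets (edgesFrom (allFin n)))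
    ≡⟨ count-exact (allFin n) (allFin⁺ n) (λ _ _ → true) (λ v → sym (dec-true (v ∈ᶠ? allFin n) (∈-allFin v)))
                   (λ _ → ≡-trans (countᵇ-allFin-true n) (sym (List.length-tabulate {n = n} (λ v → v)))) ⟩
      (length (allFin n) !) ^ r′
    ≡⟨ cong (λ m → (m !) ^ r′) (List.length-tabulate {n = n} (λ v → v)) ⟩
      (n !) ^ r′ ∎
    where open ≡-Reasoning

module _ (r′ n′ : ℕ) where

  open Hypergraph (suc r′) (suc n′)
  open Expectation (suc r′) (suc n′)

  meeting-pos : (k : ℕ) → 1 ≤ k → k ≤ suc r′ → ∃ λ a′ → meeting k ≡ suc a′
  meeting-pos (suc k) _ k<r with meeting (suc k) | ℕ.m<n⇒0<n∸m avoiding<all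
    where
      avoiding<all : n′ ^ suc k * suc n′ ^ (suc r′ ∸ suc k) < suc n′ ^ suc r′
      avoiding<all = subst (n′ ^ suc k * suc n′ ^ (suc r′ ∸ suc k) <_)
        (≡-trans (sym (ℕ.^-distribˡ-+-* (suc n′) (suc k) (suc r′ ∸ suc k))) (cong (suc n′ ^_) (ℕ.m+[n∸m]≡n k<r)))
        (ℕ.*-monoˡ-< (suc n′ ^ (suc r′ ∸ suc k)) {{ℕ.m^n≢0 (suc n′) (suc r′ ∸ suc k)}} (ℕ.^-monoˡ-< (suc k) (ℕ.n<1+n n′)))
  ... | suc a′ | _ = a′ , refl

  ι*n*P≡frac : (c j : ℕ) → j < suc r′ →
    ι c ℚ.* (ι (suc n′) ℚ.* sep-prob (suc j)) ≡ frac c ((meeting (suc j) + n′) C suc n′)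
  ι*n*P≡frac c j j<r with meeting (suc j) | meeting-pos (suc j) (s≤s z≤n) j<r
  ... | .(suc a′) | a′ , refl = ≡-trans (cong (ι c ℚ.*_) (ι-*-separation-probability n′ a′))
    (sym (frac≡ι*frac1 c ((suc a′ + n′) C suc n′) {{C≢0 (suc a′ + n′) (suc n′) (s≤s (ℕ.m≤n+m n′ a′))}}))

  ι-n*alt-sum : ι (suc n′) ℚ.* alt-sum
    ≡ sumℚ (map (λ j → sign j ℚ.* frac (suc r′ C suc j) ((meeting (suc j) + n′) C suc n′)) (upTo (suc r′)))
  ι-n*alt-sum = begin
      ι (suc n′) ℚ.* ∑ℚ (λ j → sign j ℚ.* (ι (suc r′ C suc j) ℚ.* sep-prob (suc j))) (upTo (suc r′))
    ≡⟨ ∑ℚ.∑-*ˡ (ι (suc n′)) _ (upTo (suc r′)) ⟨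
      ∑ℚ (λ j → ι (suc n′) ℚ.* (sign j ℚ.* (ι (suc r′ C suc j) ℚ.* sep-prob (suc j)))) (upTo (suc r′))
    ≡⟨ ∑ℚ.∑-cong (λ j → +-*-Solver.solve 4 (λ a s c p → a :* (s :* (c :* p)) := s :* (c :* (a :* p))) refl
                         (ι (suc n′)) (sign j) (ι (suc r′ C suc j)) (sep-prob (suc j))) (upTo (suc r′)) ⟩
      ∑ℚ (λ j → sign j ℚ.* (ι (suc r′ C suc j) ℚ.* (ι (suc n′) ℚ.* sep-prob (suc j)))) (upTo (suc r′))
    ≡⟨ ∑ℚ.∑-cong-All (All.applyUpTo⁺₁ (λ j → j) (suc r′) λ {j} j<r → cong (sign j ℚ.*_) (ι*n*P≡frac (suc r′ C suc j) j j<r)) ⟩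
      ∑ℚ (λ j → sign j ℚ.* frac (suc r′ C suc j) ((meeting (suc j) + n′) C suc n′)) (upTo (suc r′))
    ≡⟨ sumℚ-map (λ j → sign j ℚ.* frac (suc r′ C suc j) ((meeting (suc j) + n′) C suc n′)) (upTo (suc r′)) ⟨
      sumℚ (map (λ j → sign j ℚ.* frac (suc r′ C suc j) ((meeting (suc j) + n′) C suc n′)) (upTo (suc r′))) ∎
    where
      open ≡-Reasoning
      open +-*-Solver using (_:*_; _:=_)

  expectedMatchings≡formula : expectedMatchings (suc r′) (suc n′) ≡ formula (suc r′) (suc n′)
  expectedMatchings≡formula = begin
      frac (sumℕ (map (numMatchings ∘ stoppedHypergraph) (perms edges))) N!
    ≡⟨ cong (λ t → frac t N!) (sumℕ-map (numMatchings ∘ stoppedHypergraph) (perms edges)) ⟩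
      frac total N!
    ≡⟨ frac≡ι*frac1 total N! {{ℕ._!≢0 (suc n′ ^ suc r′)}} ⟩
      ι total ℚ.* frac 1 N!
    ≡⟨ cong (ℚ._* frac 1 N!) (ι-total Fin.zero Fin.zero) ⟩
      (ι M ℚ.* (ι (suc n′) ℚ.* (ι N! ℚ.* alt-sum))) ℚ.* frac 1 N!
    ≡⟨ +-*-Solver.solve 5 (λ m a c s d → (m :* (a :* (c :* s))) :* d := (m :* (a :* s)) :* (d :* c)) refl
                          (ι M) (ι (suc n′)) (ι N!) alt-sum (frac 1 N!) ⟩
      (ι M ℚ.* (ι (suc n′) ℚ.* alt-sum)) ℚ.* (frac 1 N! ℚ.* ι N!)
    ≡⟨ cong ((ι M ℚ.* (ι (suc n′) ℚ.* alt-sum)) ℚ.*_) (frac-*-ι 1 N! {{ℕ._!≢0 (suc n′ ^ suc r′)}}) ⟩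
      (ι M ℚ.* (ι (suc n′) ℚ.* alt-sum)) ℚ.* 1ℚ
    ≡⟨ ℚ.*-identityʳ _ ⟩
      ι M ℚ.* (ι (suc n′) ℚ.* alt-sum)
    ≡⟨ cong₂ ℚ._*_ (cong ι (PerfectMatchings.count-perfect-matchings r′ (suc n′))) ι-n*alt-sum ⟩
      formula (suc r′) (suc n′) ∎
    where
      open ≡-Reasoning
      open +-*-Solver using (_:*_; _:=_)
      N! = (suc n′ ^ suc r′) !
      total = ∑ (numMatchings ∘ stoppedHypergraph) (perms edges)
      M = length (filter isMatching? (subsets edges))

theorem2 : (r n : ℕ) → 2 ≤ r → 1 ≤ n → expectedMatchings r n ≡ formula r n
theorem2 (suc r′) (suc n′) _ _ = expectedMatchings≡formula r′ n′
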